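{- Let $p:\mathcal E\to\mathcal I$ be a monoidal closed type refinement system over a monoidal closed category $\mathcal I$. Then every e-type $U\sqsubset C$ gives rise to an adjunction of type refinement systems $(L\dashv R):p\dashv p^{\mathrm{op}}$, where $p^{\mathrm{op}}:\mathcal E^{\mathrm{op}}\to\mathcal I^{\mathrm{op}}$, with $L_0=C/(-):\mathcal I\to\mathcal I^{\mathrm{op}}$, $R_0=(-)\backslash C:\mathcal I^{\mathrm{op}}\to\mathcal I$, $L_1=U/(-):\mathcal E\to\mathcal E^{\mathrm{op}}$, $R_1=(-)\backslash U:\mathcal E^{\mathrm{op}}\to\mathcal E$, and to a corresponding strong monad on $p$.
   Context: A type refinement system is a functor $p:\mathcal E\to\mathcal I$; objects/morphisms of $\mathcal I$ are i-types/expressions, of $\mathcal E$ are e-types/derivations; composition is diagrammatic. $S\sqsubset A$ means $p(S)=A$; a derivation of $S\Rightarrow_f T$ is a morphism $\alpha:S\to T$ with $p(\alpha)=f$. $\mathcal I$ monoidal closed: product $\otimes$, unit $\mathbf 1$, left residual $A\backslash C$ with $\mathrm{ev}^l:A\otimes(A\backslash C)\to C$ and bijection $\lambda:\mathrm{Hom}(A\otimes X,C)\cong\mathrm{Hom}(X,A\backslash C)$ satisfying $(\mathrm{id}\otimes\lambda f);\mathrm{ev}^l=f$, $\lambda((\mathrm{id}\otimes g);\mathrm{ev}^l)=g$; right residual $C/B$ with $\mathrm{ev}^r:(C/B)\otimes B\to C$ and $\rho:\mathrm{Hom}(X\otimes B,C)\cong\mathrm{Hom}(X,C/B)$ with the analogous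 equations. A monoidal closed type refinement system is a strong monoidal functor $p$ (with $S\otimes T\sqsubset A\otimes B$ when $S\sqsubset A,T\sqsubset B$, $\mathbf 1\sqsubset\mathbf 1$) such that for all $S\sqsubset A$, $T\sqsubset B$, $U\sqsubset C$ there are e-types $S\backslash U\sqsubset A\backslash C$ with a derivation $\mathrm{ev}^l_{S,U}$ of $S\otimes(S\backslash U)\Rightarrow_{\mathrm{ev}^l}U$ and an operation $\Lambda$ from derivations $\beta$ of $S\otimes X\Rightarrow_f U$ to derivations of $X\Rightarrow_{\lambda f}S\backslash U$ with $(\mathrm{id}_S\otimes\Lambda\beta);\mathrm{ev}^l_{S,U}=\beta$ and $\Lambda((\mathrm{id}_S\otimes\eta);\mathrm{ev}^l_{S,U})=\eta$; and $U/T\sqsubset C/B$ with a derivation of $(U/T)\otimes T\Rightarrow_{\mathrm{ev}^r}U$ and an analogous operation over $\rho$ satisfying the analogous equations. For type refinement systems $p:\mathcal E\to\mathcal I$, $q:\mathcal D\to\mathcal J$, an adjunction of type refinement systems $(L\dashv R):p\dashv q$ consists of functors $L_0:\mathcal I\to\mathcal J$, $L_1:\mathcal E\to\mathcal D$, $R_0:\mathcal J\to\mathcal I$, $R_1:\mathcal D\to\mathcal E$ with $qL_1=L_0p$ and $pR_1=R_0q$, together with adjunctions $L_0\dashv R_0$ and $L_1\dashv R_1$ (units $\eta$, counits $\epsilon$) satisfying $p(\eta_S)=\eta_{pS}$ and $q(\epsilon_T)=\epsilon_{qT}$. A strong monad on $p$ (here the one induced, $R_0L_0$ on $\mathcal I$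 and $R_1L_1$ on $\mathcal E$) means: the monad $R_0L_0$ has a strength $\sigma_{A,B}:A\otimes R_0L_0B\to R_0L_0(A\otimes B)$ compatible with unit and multiplication, and $R_1L_1$ has a strength $\sigma_{S,T}:S\otimes R_1L_1T\to R_1L_1(S\otimes T)$ compatible with unit and multiplication and with $p(\sigma_{S,T})=\sigma_{pS,pT}$. -}

module Defs where

-- Composition is diagrammatic throughout:  f ⨾ g  means "first f, then g".

open import Level using (Level; _⊔_) renaming (suc to lsuc)
open import Relation.Binary using (IsEquivalence)
open import Data.Product using (Σ)

record Category (o ℓ e : Level) : Set (lsuc (o ⊔ ℓ ⊔ e)) where
  infix  4 _≈_
  infixl 7 _⨾_
  field
    Obj     : Set o
    Hom     : Obj → Obj → Set ℓ
    _≈_     : ∀ {A B} → Hom A B → Hom A B → Set e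
    ≈-equiv : ∀ {A B} → IsEquivalence (_≈_ {A} {B})
    id      : ∀ {A} → Hom A A
    _⨾_     : ∀ {A B C} → Hom A B → Hom B C → Hom A C
    assoc   : ∀ {A B C D} {f : Hom A B} {g : Hom B C} {h : Hom C D} →
              (f ⨾ g) ⨾ h ≈ f ⨾ (g ⨾ h)
    idˡ     : ∀ {A B} {f : Hom A B} → id ⨾ f ≈ f
    idʳ     : ∀ {A B} {f : Hom A B} → f ⨾ id ≈ f
    ⨾-resp  : ∀ {A B C} {f f' : Hom A B} {g g' : Hom B C} →
              f ≈ f' → g ≈ g' → f ⨾ g ≈ f' ⨾ g'

op : ∀ {o ℓ e} → Category o ℓ e → Category o ℓ e
op I = record
  { Obj     = Obj
  ; Hom     = λ A B → Hom B A
  ; _≈_     = _≈_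
  ; ≈-equiv = ≈-equiv
  ; id      = id
  ; _⨾_     = λ f g → g ⨾ f
  ; assoc   = IsEquivalence.sym ≈-equiv assoc
  ; idˡ     = idʳ
  ; idʳ     = idˡ
  ; ⨾-resp  = λ p q → ⨾-resp q p
  }
  where open Category I

record IsFunctor {o₁ ℓ₁ e₁ o₂ ℓ₂ e₂} (I : Category o₁ ℓ₁ e₁) (J : Category o₂ ℓ₂ e₂)
  (F₀ : Category.Obj I → Category.Obj J)
  (F₁ : ∀ {A B} → Category.Hom I A B → Category.Hom J (F₀ A) (F₀ B))
  : Set (o₁ ⊔ ℓ₁ ⊔ e₁ ⊔ e₂) where
  private
    module I = Category I
    module J = Category J
  field
    F-id   : ∀ {A} → F₁ (I.id {A}) J.≈ J.id
    F-⨾    : ∀ {A B C} {f : I.Hom A B} {g : I.Hom B C} → F₁ (f I.⨾ g) J.≈ F₁ f J.⨾ F₁ g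
    F-resp : ∀ {A B} {f g : I.Hom A B} → f I.≈ g → F₁ f J.≈ F₁ g

record Monoidal {o ℓ e} (I : Category o ℓ e) : Set (o ⊔ ℓ ⊔ e) where
  open Category I
  infixr 10 _⊗₀_ _⊗₁_
  field
    _⊗₀_ : Obj → Obj → Obj
    _⊗₁_ : ∀ {A A' B B'} → Hom A A' → Hom B B' → Hom (A ⊗₀ B) (A' ⊗₀ B')
    ⊗-id   : ∀ {A B} → id {A} ⊗₁ id {B} ≈ id
    ⊗-⨾    : ∀ {A A' A'' B B' B''} {f : Hom A A'} {f' : Hom A' A''}
             {g : Hom B B'} {g' : Hom B' B''} →
             (f ⨾ f') ⊗₁ (g ⨾ g') ≈ (f ⊗₁ g) ⨾ (f' ⊗₁ g')
    ⊗-resp : ∀ {A A' B B'} {f f' : Hom A A'} {g g' : Hom B B'} →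
             f ≈ f' → g ≈ g' → f ⊗₁ g ≈ f' ⊗₁ g'
    𝟙 : Obj
    α⇒ : ∀ {A B C} → Hom ((A ⊗₀ B) ⊗₀ C) (A ⊗₀ (B ⊗₀ C))
    α⇐ : ∀ {A B C} → Hom (A ⊗₀ (B ⊗₀ C)) ((A ⊗₀ B) ⊗₀ C)
    λ⇒ : ∀ {A} → Hom (𝟙 ⊗₀ A) A
    λ⇐ : ∀ {A} → Hom A (𝟙 ⊗₀ A)
    ρ⇒ : ∀ {A} → Hom (A ⊗₀ 𝟙) A
    ρ⇐ : ∀ {A} → Hom A (A ⊗₀ 𝟙)
    α-iso₁ : ∀ {A B C} → α⇒ {A} {B} {C} ⨾ α⇐ ≈ id
    α-iso₂ : ∀ {A B C} → α⇐ {A} {B} {C} ⨾ α⇒ ≈ id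
    λ-iso₁ : ∀ {A} → λ⇒ {A} ⨾ λ⇐ ≈ id
    λ-iso₂ : ∀ {A} → λ⇐ {A} ⨾ λ⇒ ≈ id
    ρ-iso₁ : ∀ {A} → ρ⇒ {A} ⨾ ρ⇐ ≈ id
    ρ-iso₂ : ∀ {A} → ρ⇐ {A} ⨾ ρ⇒ ≈ id
    α-nat : ∀ {A A' B B' C C'} {f : Hom A A'} {g : Hom B B'} {h : Hom C C'} →
            ((f ⊗₁ g) ⊗₁ h) ⨾ α⇒ ≈ α⇒ ⨾ (f ⊗₁ (g ⊗₁ h))
    λ-nat : ∀ {A A'} {f : Hom A A'} → (id {𝟙} ⊗₁ f) ⨾ λ⇒ ≈ λ⇒ ⨾ f
    ρ-nat : ∀ {A A'} {f : Hom A A'} → (f ⊗₁ id {𝟙}) ⨾ ρ⇒ ≈ ρ⇒ ⨾ f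
    pentagon : ∀ {A B C D} →
      (α⇒ {A} {B} {C} ⊗₁ id {D}) ⨾ α⇒ {A} {B ⊗₀ C} {D} ⨾ (id {A} ⊗₁ α⇒ {B} {C} {D})
        ≈ α⇒ {A ⊗₀ B} {C} {D} ⨾ α⇒ {A} {B} {C ⊗₀ D}
    triangle : ∀ {A B} →
      α⇒ {A} {𝟙} {B} ⨾ (id {A} ⊗₁ λ⇒ {B}) ≈ ρ⇒ {A} ⊗₁ id {B}

record Closed {o ℓ e} (I : Category o ℓ e) (M : Monoidal I) : Set (o ⊔ ℓ ⊔ e) where
  open Category I
  open Monoidal M
  infixr 11 _⧵_
  infixl 11 _/_
  field
    _⧵_    : Obj → Obj → Obj
    evˡ    : ∀ {A C} → Hom (A ⊗₀ (A ⧵ C)) C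
    curryˡ : ∀ {A X C} → Hom (A ⊗₀ X) C → Hom X (A ⧵ C)
    curryˡ-resp : ∀ {A X C} {f g : Hom (A ⊗₀ X) C} → f ≈ g → curryˡ f ≈ curryˡ g
    curryˡ-β : ∀ {A X C} {f : Hom (A ⊗₀ X) C} → (id {A} ⊗₁ curryˡ f) ⨾ evˡ ≈ f
    curryˡ-η : ∀ {A X C} {g : Hom X (A ⧵ C)} → curryˡ ((id {A} ⊗₁ g) ⨾ evˡ) ≈ g
    _/_    : Obj → Obj → Obj
    evʳ    : ∀ {C B} → Hom ((C / B) ⊗₀ B) C
    curryʳ : ∀ {X B C} → Hom (X ⊗₀ B) C → Hom X (C / B)
    curryʳ-resp : ∀ {X B C} {f g : Hom (X ⊗₀ B) C} → f ≈ g → curryʳ f ≈ curryʳ g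
    curryʳ-β : ∀ {X B C} {f : Hom (X ⊗₀ B) C} → (curryʳ f ⊗₁ id {B}) ⨾ evʳ ≈ f
    curryʳ-η : ∀ {X B C} {g : Hom X (C / B)} → curryʳ ((g ⊗₁ id {B}) ⨾ evʳ) ≈ g

-- Ref A      : the e-types S with S ⊏ A  (p S = A)
-- Der f S T  : the derivations of S ⇒_f T (morphisms α : S → T with p α = f)
-- α ≋ β      : equality of morphisms of E (for α, β possibly over different f, g)
-- Together these are exactly a category E with a functor p to I
-- (objects of E: pairs (A , S)⨾ morphisms: pairs (f , α)⨾ p = first projection).

record RefSys {o ℓ e} (I : Category o ℓ e) (o' ℓ' e' : Level)
  : Set (o ⊔ ℓ ⊔ e ⊔ lsuc (o' ⊔ ℓ' ⊔ e')) where
  open Category I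
  infix  4 _≋_
  infixl 7 _⨾ᵉ_
  field
    Ref : Obj → Set o'
    Der : ∀ {A B} → Hom A B → Ref A → Ref B → Set ℓ'
    _≋_ : ∀ {A B} {f g : Hom A B} {S : Ref A} {T : Ref B} →
          Der f S T → Der g S T → Set e'
    ≋-refl  : ∀ {A B} {f : Hom A B} {S T} {α : Der f S T} → α ≋ α
    ≋-sym   : ∀ {A B} {f g : Hom A B} {S T} {α : Der f S T} {β : Der g S T} →
              α ≋ β → β ≋ α
    ≋-trans : ∀ {A B} {f g h : Hom A B} {S T}
              {α : Der f S T} {β : Der g S T} {γ : Der h S T} →
              α ≋ β → β ≋ γ → α ≋ γ
    ≋⇒≈ : ∀ {A B} {f g : Hom A B} {S T} {α : Der f S T} {β : Der g S T} →
          α ≋ β → f ≈ g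
    reindex    : ∀ {A B} {f g : Hom A B} {S T} → f ≈ g → Der f S T → Der g S T
    reindex-≋  : ∀ {A B} {f g : Hom A B} {S T} (e : f ≈ g) (α : Der f S T) →
                 reindex e α ≋ α
    idᵉ  : ∀ {A} {S : Ref A} → Der id S S
    _⨾ᵉ_ : ∀ {A B C} {f : Hom A B} {g : Hom B C} {S T U} →
           Der f S T → Der g T U → Der (f ⨾ g) S U
    assocᵉ : ∀ {A B C D} {f : Hom A B} {g : Hom B C} {h : Hom C D} {S T U V}
             {α : Der f S T} {β : Der g T U} {γ : Der h U V} →
             (α ⨾ᵉ β) ⨾ᵉ γ ≋ α ⨾ᵉ (β ⨾ᵉ γ)
    idˡᵉ : ∀ {A B} {f : Hom A B} {S T} {α : Der f S T} → idᵉ ⨾ᵉ α ≋ α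
    idʳᵉ : ∀ {A B} {f : Hom A B} {S T} {α : Der f S T} → α ⨾ᵉ idᵉ ≋ α
    ⨾ᵉ-resp : ∀ {A B C} {f f' : Hom A B} {g g' : Hom B C} {S T U}
              {α : Der f S T} {α' : Der f' S T} {β : Der g T U} {β' : Der g' T U} →
              α ≋ α' → β ≋ β' → α ⨾ᵉ β ≋ α' ⨾ᵉ β'

opRS : ∀ {o ℓ e o' ℓ' e'} {I : Category o ℓ e} → RefSys I o' ℓ' e' → RefSys (op I) o' ℓ' e'
opRS p = record
  { Ref = Ref
  ; Der = λ f S T → Der f T S
  ; _≋_ = _≋_
  ; ≋-refl = ≋-refl
  ; ≋-sym = ≋-sym
  ; ≋-trans = ≋-trans
  ; ≋⇒≈ = ≋⇒≈
  ; reindex = reindex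
  ; reindex-≋ = reindex-≋
  ; idᵉ = idᵉ
  ; _⨾ᵉ_ = λ α β → β ⨾ᵉ α
  ; assocᵉ = ≋-sym assocᵉ
  ; idˡᵉ = idʳᵉ
  ; idʳᵉ = idˡᵉ
  ; ⨾ᵉ-resp = λ p q → ⨾ᵉ-resp q p
  }
  where open RefSys p

record IsFunctorOver {o₁ ℓ₁ e₁ o₂ ℓ₂ e₂ o₁' ℓ₁' e₁' o₂' ℓ₂' e₂'}
  {I : Category o₁ ℓ₁ e₁} {J : Category o₂ ℓ₂ e₂}
  (p : RefSys I o₁' ℓ₁' e₁') (q : RefSys J o₂' ℓ₂' e₂')
  (F₀ : Category.Obj I → Category.Obj J)
  (F₁ : ∀ {A B} → Category.Hom I A B → Category.Hom J (F₀ A) (F₀ B))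
  (G₀ : ∀ {A} → RefSys.Ref p A → RefSys.Ref q (F₀ A))
  (G₁ : ∀ {A B} {f : Category.Hom I A B} {S T} →
        RefSys.Der p f S T → RefSys.Der q (F₁ f) (G₀ S) (G₀ T))
  : Set (o₁ ⊔ ℓ₁ ⊔ o₁' ⊔ ℓ₁' ⊔ e₁' ⊔ e₂') where
  private
    module p = RefSys p
    module q = RefSys q
  field
    G-id   : ∀ {A} {S : p.Ref A} → G₁ (p.idᵉ {S = S}) q.≋ q.idᵉ
    G-⨾    : ∀ {A B C} {f : Category.Hom I A B} {g : Category.Hom I B C} {S T U}
             {α : p.Der f S T} {β : p.Der g T U} →
             G₁ (α p.⨾ᵉ β) q.≋ G₁ α q.⨾ᵉ G₁ β
    G-resp : ∀ {A B} {f g : Category.Hom I A B} {S T} {α : p.Der f S T} {β : p.Der g S T} →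
             α p.≋ β → G₁ α q.≋ G₁ β

-- Monoidal closed type refinement systems (p strict monoidal: S ⊗ T ⊏ A ⊗ B,
-- 𝟙 ⊏ 𝟙, and the structure maps of E lie over those of I)

record MonoidalRS {o ℓ e o' ℓ' e'} (I : Category o ℓ e) (M : Monoidal I)
  (p : RefSys I o' ℓ' e') : Set (o ⊔ ℓ ⊔ o' ⊔ ℓ' ⊔ e') where
  open Category I
  open Monoidal M
  open RefSys p
  infixr 10 _⊗ᵉ_ _⊗ᵉ₁_
  field
    _⊗ᵉ_  : ∀ {A B} → Ref A → Ref B → Ref (A ⊗₀ B)
    _⊗ᵉ₁_ : ∀ {A A' B B'} {f : Hom A A'} {g : Hom B B'} {S S' T T'} →
            Der f S S' → Der g T T' → Der (f ⊗₁ g) (S ⊗ᵉ T) (S' ⊗ᵉ T')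
    ⊗ᵉ-id   : ∀ {A B} {S : Ref A} {T : Ref B} → idᵉ {S = S} ⊗ᵉ₁ idᵉ {S = T} ≋ idᵉ
    ⊗ᵉ-⨾    : ∀ {A A' A'' B B' B''} {f : Hom A A'} {f' : Hom A' A''}
              {g : Hom B B'} {g' : Hom B' B''} {S S' S'' T T' T''}
              {α : Der f S S'} {α' : Der f' S' S''} {β : Der g T T'} {β' : Der g' T' T''} →
              (α ⨾ᵉ α') ⊗ᵉ₁ (β ⨾ᵉ β') ≋ (α ⊗ᵉ₁ β) ⨾ᵉ (α' ⊗ᵉ₁ β')
    ⊗ᵉ-resp : ∀ {A A' B B'} {f f' : Hom A A'} {g g' : Hom B B'} {S S' T T'}
              {α : Der f S S'} {α' : Der f' S S'} {β : Der g T T'} {β' : Der g' T T'} →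
              α ≋ α' → β ≋ β' → α ⊗ᵉ₁ β ≋ α' ⊗ᵉ₁ β'
    𝟙ᵉ : Ref 𝟙
    αᵉ⇒ : ∀ {A B C} {S : Ref A} {T : Ref B} {U : Ref C} →
          Der α⇒ ((S ⊗ᵉ T) ⊗ᵉ U) (S ⊗ᵉ (T ⊗ᵉ U))
    αᵉ⇐ : ∀ {A B C} {S : Ref A} {T : Ref B} {U : Ref C} →
          Der α⇐ (S ⊗ᵉ (T ⊗ᵉ U)) ((S ⊗ᵉ T) ⊗ᵉ U)
    λᵉ⇒ : ∀ {A} {S : Ref A} → Der λ⇒ (𝟙ᵉ ⊗ᵉ S) S
    λᵉ⇐ : ∀ {A} {S : Ref A} → Der λ⇐ S (𝟙ᵉ ⊗ᵉ S)
    ρᵉ⇒ : ∀ {A} {S : Ref A} → Der ρ⇒ (S ⊗ᵉ 𝟙ᵉ) S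
    ρᵉ⇐ : ∀ {A} {S : Ref A} → Der ρ⇐ S (S ⊗ᵉ 𝟙ᵉ)
    αᵉ-iso₁ : ∀ {A B C} {S : Ref A} {T : Ref B} {U : Ref C} →
              αᵉ⇒ {S = S} {T} {U} ⨾ᵉ αᵉ⇐ ≋ idᵉ
    αᵉ-iso₂ : ∀ {A B C} {S : Ref A} {T : Ref B} {U : Ref C} →
              αᵉ⇐ {S = S} {T} {U} ⨾ᵉ αᵉ⇒ ≋ idᵉ
    λᵉ-iso₁ : ∀ {A} {S : Ref A} → λᵉ⇒ {S = S} ⨾ᵉ λᵉ⇐ ≋ idᵉ
    λᵉ-iso₂ : ∀ {A} {S : Ref A} → λᵉ⇐ {S = S} ⨾ᵉ λᵉ⇒ ≋ idᵉ
    ρᵉ-iso₁ : ∀ {A} {S : Ref A} → ρᵉ⇒ {S = S} ⨾ᵉ ρᵉ⇐ ≋ idᵉ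
    ρᵉ-iso₂ : ∀ {A} {S : Ref A} → ρᵉ⇐ {S = S} ⨾ᵉ ρᵉ⇒ ≋ idᵉ
    αᵉ-nat : ∀ {A A' B B' C C'} {f : Hom A A'} {g : Hom B B'} {h : Hom C C'}
             {S S' T T' U U'} {α : Der f S S'} {β : Der g T T'} {γ : Der h U U'} →
             ((α ⊗ᵉ₁ β) ⊗ᵉ₁ γ) ⨾ᵉ αᵉ⇒ ≋ αᵉ⇒ ⨾ᵉ (α ⊗ᵉ₁ (β ⊗ᵉ₁ γ))
    λᵉ-nat : ∀ {A A'} {f : Hom A A'} {S S'} {α : Der f S S'} →
             (idᵉ {S = 𝟙ᵉ} ⊗ᵉ₁ α) ⨾ᵉ λᵉ⇒ ≋ λᵉ⇒ ⨾ᵉ α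
    ρᵉ-nat : ∀ {A A'} {f : Hom A A'} {S S'} {α : Der f S S'} →
             (α ⊗ᵉ₁ idᵉ {S = 𝟙ᵉ}) ⨾ᵉ ρᵉ⇒ ≋ ρᵉ⇒ ⨾ᵉ α
    pentagonᵉ : ∀ {A B C D} {S : Ref A} {T : Ref B} {U : Ref C} {V : Ref D} →
      (αᵉ⇒ {S = S} {T} {U} ⊗ᵉ₁ idᵉ {S = V}) ⨾ᵉ αᵉ⇒ {S = S} {T ⊗ᵉ U} {V}
        ⨾ᵉ (idᵉ {S = S} ⊗ᵉ₁ αᵉ⇒ {S = T} {U} {V})
        ≋ αᵉ⇒ {S = S ⊗ᵉ T} {U} {V} ⨾ᵉ αᵉ⇒ {S = S} {T} {U ⊗ᵉ V}
    triangleᵉ : ∀ {A B} {S : Ref A} {T : Ref B} →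
      αᵉ⇒ {S = S} {𝟙ᵉ} {T} ⨾ᵉ (idᵉ {S = S} ⊗ᵉ₁ λᵉ⇒ {S = T}) ≋ ρᵉ⇒ {S = S} ⊗ᵉ₁ idᵉ {S = T}

record ClosedRS {o ℓ e o' ℓ' e'} (I : Category o ℓ e) (M : Monoidal I) (Cl : Closed I M)
  (p : RefSys I o' ℓ' e') (Mp : MonoidalRS I M p) : Set (o ⊔ ℓ ⊔ o' ⊔ ℓ' ⊔ e') where
  open Category I
  open Monoidal M
  open Closed Cl
  open RefSys p
  open MonoidalRS Mp
  infixr 11 _⧵ᵉ_
  infixl 11 _/ᵉ_
  field
    _⧵ᵉ_ : ∀ {A C} → Ref A → Ref C → Ref (A ⧵ C)
    evˡᵉ : ∀ {A C} {S : Ref A} {U : Ref C} → Der evˡ (S ⊗ᵉ (S ⧵ᵉ U)) U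
    Λˡ   : ∀ {A B C} {f : Hom (A ⊗₀ B) C} {S : Ref A} {X : Ref B} {U : Ref C} →
           Der f (S ⊗ᵉ X) U → Der (curryˡ f) X (S ⧵ᵉ U)
    Λˡ-resp : ∀ {A B C} {f g : Hom (A ⊗₀ B) C} {S : Ref A} {X : Ref B} {U : Ref C}
              {β : Der f (S ⊗ᵉ X) U} {β' : Der g (S ⊗ᵉ X) U} → β ≋ β' → Λˡ β ≋ Λˡ β'
    Λˡ-β : ∀ {A B C} {f : Hom (A ⊗₀ B) C} {S : Ref A} {X : Ref B} {U : Ref C}
           {β : Der f (S ⊗ᵉ X) U} → (idᵉ {S = S} ⊗ᵉ₁ Λˡ β) ⨾ᵉ evˡᵉ ≋ β
    Λˡ-η : ∀ {A B C} {g : Hom B (A ⧵ C)} {S : Ref A} {X : Ref B} {U : Ref C}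
           {η : Der g X (S ⧵ᵉ U)} → Λˡ ((idᵉ {S = S} ⊗ᵉ₁ η) ⨾ᵉ evˡᵉ) ≋ η
    _/ᵉ_ : ∀ {C B} → Ref C → Ref B → Ref (C / B)
    evʳᵉ : ∀ {C B} {U : Ref C} {T : Ref B} → Der evʳ ((U /ᵉ T) ⊗ᵉ T) U
    Λʳ   : ∀ {A B C} {f : Hom (A ⊗₀ B) C} {X : Ref A} {T : Ref B} {U : Ref C} →
           Der f (X ⊗ᵉ T) U → Der (curryʳ f) X (U /ᵉ T)
    Λʳ-resp : ∀ {A B C} {f g : Hom (A ⊗₀ B) C} {X : Ref A} {T : Ref B} {U : Ref C}
              {β : Der f (X ⊗ᵉ T) U} {β' : Der g (X ⊗ᵉ T) U} → β ≋ β' → Λʳ β ≋ Λʳ β'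
    Λʳ-β : ∀ {A B C} {f : Hom (A ⊗₀ B) C} {X : Ref A} {T : Ref B} {U : Ref C}
           {β : Der f (X ⊗ᵉ T) U} → (Λʳ β ⊗ᵉ₁ idᵉ {S = T}) ⨾ᵉ evʳᵉ ≋ β
    Λʳ-η : ∀ {A B C} {g : Hom A (C / B)} {X : Ref A} {T : Ref B} {U : Ref C}
           {η : Der g X (U /ᵉ T)} → Λʳ ((η ⊗ᵉ₁ idᵉ {S = T}) ⨾ᵉ evʳᵉ) ≋ η

-- Adjunctions of type refinement systems  (L ⊣ R) : p ⊣ q,
-- for given functor actions L₀, R₀ (base) and L₁, R₁ (lying over them, so
-- that q L₁ = L₀ p and p R₁ = R₀ q hold by construction).

record TRSAdjunction {o₁ ℓ₁ e₁ o₂ ℓ₂ e₂ o₁' ℓ₁' e₁' o₂' ℓ₂' e₂'}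
  {I : Category o₁ ℓ₁ e₁} {J : Category o₂ ℓ₂ e₂}
  (p : RefSys I o₁' ℓ₁' e₁') (q : RefSys J o₂' ℓ₂' e₂')
  (L0₀ : Category.Obj I → Category.Obj J)
  (L0₁ : ∀ {A B} → Category.Hom I A B → Category.Hom J (L0₀ A) (L0₀ B))
  (R0₀ : Category.Obj J → Category.Obj I)
  (R0₁ : ∀ {X Y} → Category.Hom J X Y → Category.Hom I (R0₀ X) (R0₀ Y))
  (L1₀ : ∀ {A} → RefSys.Ref p A → RefSys.Ref q (L0₀ A))
  (L1₁ : ∀ {A B} {f : Category.Hom I A B} {S T} →
         RefSys.Der p f S T → RefSys.Der q (L0₁ f) (L1₀ S) (L1₀ T))
  (R1₀ : ∀ {X} → RefSys.Ref q X → RefSys.Ref p (R0₀ X))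
  (R1₁ : ∀ {X Y} {g : Category.Hom J X Y} {S T} →
         RefSys.Der q g S T → RefSys.Der p (R0₁ g) (R1₀ S) (R1₀ T))
  : Set (o₁ ⊔ ℓ₁ ⊔ e₁ ⊔ o₂ ⊔ ℓ₂ ⊔ e₂ ⊔ o₁' ⊔ ℓ₁' ⊔ e₁' ⊔ o₂' ⊔ ℓ₂' ⊔ e₂') where
  private
    module I = Category I
    module J = Category J
    module p = RefSys p
    module q = RefSys q
  field
    L0-functor : IsFunctor I J L0₀ L0₁
    R0-functor : IsFunctor J I R0₀ R0₁
    L1-functor : IsFunctorOver p q L0₀ L0₁ L1₀ L1₁
    R1-functor : IsFunctorOver q p R0₀ R0₁ R1₀ R1₁
    η     : ∀ {A} → I.Hom A (R0₀ (L0₀ A))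
    η-nat : ∀ {A B} (f : I.Hom A B) → f I.⨾ η I.≈ η I.⨾ R0₁ (L0₁ f)
    ε     : ∀ {X} → J.Hom (L0₀ (R0₀ X)) X
    ε-nat : ∀ {X Y} (g : J.Hom X Y) → L0₁ (R0₁ g) J.⨾ ε J.≈ ε J.⨾ g
    tri₁  : ∀ {A} → L0₁ (η {A}) J.⨾ ε {L0₀ A} J.≈ J.id
    tri₂  : ∀ {X} → η {R0₀ X} I.⨾ R0₁ (ε {X}) I.≈ I.id
    ηᵉ     : ∀ {A} {S : p.Ref A} → p.Der (η {A}) S (R1₀ (L1₀ S))
    ηᵉ-nat : ∀ {A B} {f : I.Hom A B} {S T} (α : p.Der f S T) →
             α p.⨾ᵉ ηᵉ p.≋ ηᵉ p.⨾ᵉ R1₁ (L1₁ α)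
    εᵉ     : ∀ {X} {T : q.Ref X} → q.Der (ε {X}) (L1₀ (R1₀ T)) T
    εᵉ-nat : ∀ {X Y} {g : J.Hom X Y} {S T} (β : q.Der g S T) →
             L1₁ (R1₁ β) q.⨾ᵉ εᵉ q.≋ εᵉ q.⨾ᵉ β
    triᵉ₁  : ∀ {A} {S : p.Ref A} → L1₁ (ηᵉ {S = S}) q.⨾ᵉ εᵉ q.≋ q.idᵉ
    triᵉ₂  : ∀ {X} {T : q.Ref X} → ηᵉ {S = R1₀ T} p.⨾ᵉ R1₁ (εᵉ {T = T}) p.≋ p.idᵉ

record IsStrong {o ℓ e o' ℓ' e'} (I : Category o ℓ e) (M : Monoidal I)
  (p : RefSys I o' ℓ' e') (Mp : MonoidalRS I M p)
  (T₀ : Category.Obj I → Category.Obj I)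
  (T₁ : ∀ {A B} → Category.Hom I A B → Category.Hom I (T₀ A) (T₀ B))
  (η  : ∀ {A} → Category.Hom I A (T₀ A))
  (μ  : ∀ {A} → Category.Hom I (T₀ (T₀ A)) (T₀ A))
  (T₀ᵉ : ∀ {A} → RefSys.Ref p A → RefSys.Ref p (T₀ A))
  (T₁ᵉ : ∀ {A B} {f : Category.Hom I A B} {S T} →
         RefSys.Der p f S T → RefSys.Der p (T₁ f) (T₀ᵉ S) (T₀ᵉ T))
  (ηᵉ : ∀ {A} {S : RefSys.Ref p A} → RefSys.Der p (η {A}) S (T₀ᵉ S))
  (μᵉ : ∀ {A} {S : RefSys.Ref p A} → RefSys.Der p (μ {A}) (T₀ᵉ (T₀ᵉ S)) (T₀ᵉ S))
  : Set (o ⊔ ℓ ⊔ e ⊔ o' ⊔ ℓ' ⊔ e') where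
  open Category I
  open Monoidal M
  open RefSys p
  open MonoidalRS Mp
  field
    σ : ∀ {A B} → Hom (A ⊗₀ T₀ B) (T₀ (A ⊗₀ B))
    σ-nat : ∀ {A A' B B'} (f : Hom A A') (g : Hom B B') →
            (f ⊗₁ T₁ g) ⨾ σ ≈ σ ⨾ T₁ (f ⊗₁ g)
    σ-λ : ∀ {B} → σ {𝟙} {B} ⨾ T₁ (λ⇒ {B}) ≈ λ⇒ {T₀ B}
    σ-α : ∀ {A B C} →
          σ {A ⊗₀ B} {C} ⨾ T₁ (α⇒ {A} {B} {C})
            ≈ α⇒ {A} {B} {T₀ C} ⨾ (id {A} ⊗₁ σ {B} {C}) ⨾ σ {A} {B ⊗₀ C}
    σ-η : ∀ {A B} → (id {A} ⊗₁ η {B}) ⨾ σ {A} {B} ≈ η {A ⊗₀ B}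
    σ-μ : ∀ {A B} → (id {A} ⊗₁ μ {B}) ⨾ σ {A} {B}
                      ≈ σ {A} {T₀ B} ⨾ T₁ (σ {A} {B}) ⨾ μ {A ⊗₀ B}
    σᵉ : ∀ {A B} {S : Ref A} {T : Ref B} → Der (σ {A} {B}) (S ⊗ᵉ T₀ᵉ T) (T₀ᵉ (S ⊗ᵉ T))
    σᵉ-nat : ∀ {A A' B B'} {f : Hom A A'} {g : Hom B B'} {S S' T T'}
             (α : Der f S S') (β : Der g T T') →
             (α ⊗ᵉ₁ T₁ᵉ β) ⨾ᵉ σᵉ ≋ σᵉ ⨾ᵉ T₁ᵉ (α ⊗ᵉ₁ β)
    σᵉ-λ : ∀ {B} {T : Ref B} → σᵉ {S = 𝟙ᵉ} {T} ⨾ᵉ T₁ᵉ (λᵉ⇒ {S = T}) ≋ λᵉ⇒ {S = T₀ᵉ T}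
    σᵉ-α : ∀ {A B C} {S : Ref A} {T : Ref B} {U : Ref C} →
           σᵉ {S = S ⊗ᵉ T} {U} ⨾ᵉ T₁ᵉ (αᵉ⇒ {S = S} {T} {U})
             ≋ αᵉ⇒ {S = S} {T} {T₀ᵉ U} ⨾ᵉ (idᵉ {S = S} ⊗ᵉ₁ σᵉ {S = T} {U}) ⨾ᵉ σᵉ {S = S} {T ⊗ᵉ U}
    σᵉ-η : ∀ {A B} {S : Ref A} {T : Ref B} →
           (idᵉ {S = S} ⊗ᵉ₁ ηᵉ {S = T}) ⨾ᵉ σᵉ ≋ ηᵉ {S = S ⊗ᵉ T}
    σᵉ-μ : ∀ {A B} {S : Ref A} {T : Ref B} →
           (idᵉ {S = S} ⊗ᵉ₁ μᵉ {S = T}) ⨾ᵉ σᵉ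
             ≋ σᵉ {S = S} {T₀ᵉ T} ⨾ᵉ T₁ᵉ (σᵉ {S = S} {T}) ⨾ᵉ μᵉ {S = S ⊗ᵉ T}

InducedMonadIsStrong :
  ∀ {o₁ ℓ₁ e₁ o₂ ℓ₂ e₂ o₁' ℓ₁' e₁' o₂' ℓ₂' e₂'}
  {I : Category o₁ ℓ₁ e₁} {J : Category o₂ ℓ₂ e₂}
  (M : Monoidal I) {p : RefSys I o₁' ℓ₁' e₁'} (Mp : MonoidalRS I M p)
  {q : RefSys J o₂' ℓ₂' e₂'}
  {L0₀ : Category.Obj I → Category.Obj J}
  {L0₁ : ∀ {A B} → Category.Hom I A B → Category.Hom J (L0₀ A) (L0₀ B)}
  {R0₀ : Category.Obj J → Category.Obj I}
  {R0₁ : ∀ {X Y} → Category.Hom J X Y → Category.Hom I (R0₀ X) (R0₀ Y)}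
  {L1₀ : ∀ {A} → RefSys.Ref p A → RefSys.Ref q (L0₀ A)}
  {L1₁ : ∀ {A B} {f : Category.Hom I A B} {S T} →
         RefSys.Der p f S T → RefSys.Der q (L0₁ f) (L1₀ S) (L1₀ T)}
  {R1₀ : ∀ {X} → RefSys.Ref q X → RefSys.Ref p (R0₀ X)}
  {R1₁ : ∀ {X Y} {g : Category.Hom J X Y} {S T} →
         RefSys.Der q g S T → RefSys.Der p (R0₁ g) (R1₀ S) (R1₀ T)} →
  TRSAdjunction p q L0₀ L0₁ R0₀ R0₁ L1₀ L1₁ R1₀ R1₁ →
  Set (o₁ ⊔ ℓ₁ ⊔ e₁ ⊔ o₁' ⊔ ℓ₁' ⊔ e₁')
InducedMonadIsStrong {I = I} M {p} Mp {L0₀ = L0₀} {L0₁} {R0₀} {R0₁} {L1₀} {L1₁} {R1₀} {R1₁} adj =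
  IsStrong I M p Mp
    (λ A → R0₀ (L0₀ A)) (λ f → R0₁ (L0₁ f))
    η (λ {A} → R0₁ (ε {L0₀ A}))
    (λ S → R1₀ (L1₀ S)) (λ α → R1₁ (L1₁ α))
    ηᵉ (λ {A} {S} → R1₁ (εᵉ {T = L1₀ S}))
  where open TRSAdjunction adj

module ContinuationFunctors {o ℓ e o' ℓ' e'} (I : Category o ℓ e) (M : Monoidal I)
  (Cl : Closed I M) (p : RefSys I o' ℓ' e') (Mp : MonoidalRS I M p)
  (Clp : ClosedRS I M Cl p Mp) {C : Category.Obj I} (U : RefSys.Ref p C) where
  open Category I
  open Monoidal M
  open Closed Cl
  open RefSys p
  open MonoidalRS Mp
  open ClosedRS Clp

  L0₀ : Obj → Obj
  L0₀ A = C / A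

  L0₁ : ∀ {A B} → Hom A B → Category.Hom (op I) (L0₀ A) (L0₀ B)
  L0₁ {A} {B} f = curryʳ ((id {C / B} ⊗₁ f) ⨾ evʳ)

  R0₀ : Obj → Obj
  R0₀ X = X ⧵ C

  R0₁ : ∀ {X Y} → Category.Hom (op I) X Y → Hom (R0₀ X) (R0₀ Y)
  R0₁ {X} {Y} g = curryˡ ((g ⊗₁ id {X ⧵ C}) ⨾ evˡ)

  L1₀ : ∀ {A} → Ref A → Ref (L0₀ A)
  L1₀ S = U /ᵉ S

  L1₁ : ∀ {A B} {f : Hom A B} {S T} → Der f S T →
        RefSys.Der (opRS p) (L0₁ f) (L1₀ S) (L1₀ T)
  L1₁ {T = T} α = Λʳ ((idᵉ {S = U /ᵉ T} ⊗ᵉ₁ α) ⨾ᵉ evʳᵉ)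

  R1₀ : ∀ {X} → Ref X → Ref (R0₀ X)
  R1₀ T = T ⧵ᵉ U

  R1₁ : ∀ {X Y} {g : Category.Hom (op I) X Y} {S T} →
        RefSys.Der (opRS p) g S T → Der (R0₁ g) (R1₀ S) (R1₀ T)
  R1₁ {S = S} α = Λˡ ((α ⊗ᵉ₁ idᵉ {S = S ⧵ᵉ U}) ⨾ᵉ evˡᵉ)

  ContinuationAdjunction : Set (o ⊔ ℓ ⊔ e ⊔ o' ⊔ ℓ' ⊔ e')
  ContinuationAdjunction =
    TRSAdjunction p (opRS p) L0₀ L0₁ R0₀ R0₁ L1₀ L1₁ R1₀ R1₁

module Submission where

-- Everything the theorem asks for -- the functors U/(-) and (-)⧵U, the
-- unit and counit of U/(-) ⊣ (-)⧵U, the triangle identities, and the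
-- strength of the induced monad (-)⧵U ∘ U/(-) with its four coherence
-- laws -- is an equational fact about an arbitrary monoidal closed
-- category 𝒞 and object U of 𝒞.  Each is proved once, in that
-- generality (module Continuation), by the universal property of the
-- residuals: two maps into A ⧵ U (or U / A) are equal as soon as they
-- agree after evaluation (curryˡ-unique, curryʳ-unique).
--
-- The theorem then follows by instantiating this development twice:
--  * at the base 𝒞 = I and the object C, giving L₀ ⊣ R₀ over I;
--  * at the total category ∫p of the refinement system (objects: pairs
--    (A , S) with S ⊏ A; morphisms: pairs (f , α) with α a derivation
--    over f), which is monoidal closed componentwise (module Total),
--    and the object (C , U), giving L₁ ⊣ R₁.
-- Since every structure map of ∫p is a pair (base map , derivation),
-- the second instantiation lies over the first by construction, which
-- is exactly the "lying over" condition of a type refinement adjunction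
-- and of a strength on p.

open import Defs
open import Data.Product using (Σ; _,_; proj₁; proj₂)
open import Level using (_⊔_)
open import Relation.Binary using (IsEquivalence; Setoid)
import Relation.Binary.Reasoning.Setoid as SetoidReasoning

module HomReasoning {o ℓ e} (I : Category o ℓ e) where
  open Category I

  hom-setoid : Obj → Obj → Setoid ℓ e
  hom-setoid A B = record { Carrier = Hom A B ; _≈_ = _≈_ ; isEquivalence = ≈-equiv }

  module _ {A B : Obj} where
    open IsEquivalence (≈-equiv {A} {B}) public using (refl; sym; trans)
    open SetoidReasoning (hom-setoid A B) public

  ⨾-congˡ : ∀ {A B C} {f f' : Hom A B} {g : Hom B C} → f ≈ f' → f ⨾ g ≈ f' ⨾ g
  ⨾-congˡ eq = ⨾-resp eq refl

  ⨾-congʳ : ∀ {A B C} {f : Hom A B} {g g' : Hom B C} → g ≈ g' → f ⨾ g ≈ f ⨾ g'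
  ⨾-congʳ eq = ⨾-resp refl eq

  assoc˘ : ∀ {A B C D} {f : Hom A B} {g : Hom B C} {h : Hom C D} → f ⨾ (g ⨾ h) ≈ (f ⨾ g) ⨾ h
  assoc˘ = sym assoc

  pullˡ : ∀ {A B C D} {f : Hom A B} {g : Hom B C} {h : Hom A C} {k : Hom C D} →
          f ⨾ g ≈ h → f ⨾ (g ⨾ k) ≈ h ⨾ k
  pullˡ eq = trans assoc˘ (⨾-congˡ eq)

  extend : ∀ {A B B' C D} {f : Hom A B} {g : Hom B C} {f' : Hom A B'} {g' : Hom B' C}
           {k : Hom C D} → f ⨾ g ≈ f' ⨾ g' → f ⨾ (g ⨾ k) ≈ f' ⨾ (g' ⨾ k)
  extend eq = trans (pullˡ eq) assoc

  cancelˡ : ∀ {A B C} {f : Hom A B} {g : Hom B A} {k : Hom A C} →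
            f ⨾ g ≈ id → f ⨾ (g ⨾ k) ≈ k
  cancelˡ eq = trans (pullˡ eq) idˡ

  cancel-split-mono : ∀ {A B B'} {f g : Hom A B} {m : Hom B B'} {m' : Hom B' B} →
               m ⨾ m' ≈ id → f ⨾ m ≈ g ⨾ m → f ≈ g
  cancel-split-mono {f = f} {g} {m} {m'} inv eq = begin
    f              ≈⟨ sym idʳ ⟩
    f ⨾ id         ≈⟨ ⨾-congʳ (sym inv) ⟩
    f ⨾ (m ⨾ m')   ≈⟨ extend eq ⟩
    g ⨾ (m ⨾ m')   ≈⟨ ⨾-congʳ inv ⟩
    g ⨾ id         ≈⟨ idʳ ⟩
    g              ∎

module MonoidalLemmas {o ℓ e} {I : Category o ℓ e} (M : Monoidal I) where
  open Category I
  open Monoidal M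
  open HomReasoning I

  ⊗-split₁ : ∀ {A A' B B'} {f : Hom A A'} {g : Hom B B'} → f ⊗₁ g ≈ (f ⊗₁ id) ⨾ (id ⊗₁ g)
  ⊗-split₁ = trans (⊗-resp (sym idʳ) (sym idˡ)) ⊗-⨾

  ⊗-split₂ : ∀ {A A' B B'} {f : Hom A A'} {g : Hom B B'} → f ⊗₁ g ≈ (id ⊗₁ g) ⨾ (f ⊗₁ id)
  ⊗-split₂ = trans (⊗-resp (sym idˡ) (sym idʳ)) ⊗-⨾

  ⊗-interchange : ∀ {A A' B B'} {f : Hom A A'} {g : Hom B B'} →
                  (f ⊗₁ id) ⨾ (id ⊗₁ g) ≈ (id ⊗₁ g) ⨾ (f ⊗₁ id)
  ⊗-interchange = trans (sym ⊗-split₁) ⊗-split₂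

  ⊗-interchange-⨾ : ∀ {A A' B B' D} {f : Hom A A'} {g : Hom B B'} {k : Hom (A' ⊗₀ B') D} →
                    (f ⊗₁ id) ⨾ ((id ⊗₁ g) ⨾ k) ≈ (id ⊗₁ g) ⨾ ((f ⊗₁ id) ⨾ k)
  ⊗-interchange-⨾ = extend ⊗-interchange

  id⊗-cong : ∀ {A B B'} {g g' : Hom B B'} → g ≈ g' → id {A} ⊗₁ g ≈ id ⊗₁ g'
  id⊗-cong eq = ⊗-resp refl eq

  ⊗id-cong : ∀ {A A' B} {f f' : Hom A A'} → f ≈ f' → f ⊗₁ id {B} ≈ f' ⊗₁ id
  ⊗id-cong eq = ⊗-resp eq refl

  id⊗-⨾ : ∀ {A B B' B''} {g : Hom B B'} {g' : Hom B' B''} →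
          id {A} ⊗₁ (g ⨾ g') ≈ (id ⊗₁ g) ⨾ (id ⊗₁ g')
  id⊗-⨾ = trans (⊗-resp (sym idˡ) refl) ⊗-⨾

  ⨾-⊗id : ∀ {A A' A'' B} {f : Hom A A'} {f' : Hom A' A''} →
          (f ⨾ f') ⊗₁ id {B} ≈ (f ⊗₁ id) ⨾ (f' ⊗₁ id)
  ⨾-⊗id = trans (⊗-resp refl (sym idˡ)) ⊗-⨾

  id⊗-⨾-assoc : ∀ {A B B' B'' D} {g : Hom B B'} {g' : Hom B' B''} {k : Hom (A ⊗₀ B'') D} →
                (id ⊗₁ (g ⨾ g')) ⨾ k ≈ (id ⊗₁ g) ⨾ ((id ⊗₁ g') ⨾ k)
  id⊗-⨾-assoc = trans (⨾-congˡ id⊗-⨾) assoc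

  ⨾-⊗id-assoc : ∀ {A A' A'' B D} {f : Hom A A'} {f' : Hom A' A''} {k : Hom (A'' ⊗₀ B) D} →
                ((f ⨾ f') ⊗₁ id) ⨾ k ≈ (f ⊗₁ id) ⨾ ((f' ⊗₁ id) ⨾ k)
  ⨾-⊗id-assoc = trans (⨾-congˡ ⨾-⊗id) assoc

  id⊗id-intro : ∀ {A B D} {k : Hom (A ⊗₀ B) D} → k ≈ (id ⊗₁ id) ⨾ k
  id⊗id-intro = sym (trans (⨾-congˡ ⊗-id) idˡ)

  id⊗-iso : ∀ {A B B'} {g : Hom B B'} {g' : Hom B' B} → g ⨾ g' ≈ id →
            (id {A} ⊗₁ g) ⨾ (id ⊗₁ g') ≈ id
  id⊗-iso inv = trans (sym id⊗-⨾) (trans (id⊗-cong inv) ⊗-id)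

  ⊗id-iso : ∀ {A A' B} {f : Hom A A'} {f' : Hom A' A} → f ⨾ f' ≈ id →
            (f ⊗₁ id {B}) ⨾ (f' ⊗₁ id) ≈ id
  ⊗id-iso inv = trans (sym ⨾-⊗id) (trans (⊗id-cong inv) ⊗-id)

  α⇐-nat : ∀ {A A' B B' D D'} {f : Hom A A'} {g : Hom B B'} {h : Hom D D'} →
           (f ⊗₁ (g ⊗₁ h)) ⨾ α⇐ ≈ α⇐ ⨾ ((f ⊗₁ g) ⊗₁ h)
  α⇐-nat {f = f} {g} {h} = begin
    (f ⊗₁ (g ⊗₁ h)) ⨾ α⇐                     ≈⟨ sym idˡ ⟩
    id ⨾ ((f ⊗₁ (g ⊗₁ h)) ⨾ α⇐)              ≈⟨ ⨾-congˡ (sym α-iso₂) ⟩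
    (α⇐ ⨾ α⇒) ⨾ ((f ⊗₁ (g ⊗₁ h)) ⨾ α⇐)       ≈⟨ trans assoc (⨾-congʳ assoc˘) ⟩
    α⇐ ⨾ ((α⇒ ⨾ (f ⊗₁ (g ⊗₁ h))) ⨾ α⇐)       ≈⟨ ⨾-congʳ (⨾-congˡ (sym α-nat)) ⟩
    α⇐ ⨾ ((((f ⊗₁ g) ⊗₁ h) ⨾ α⇒) ⨾ α⇐)       ≈⟨ ⨾-congʳ (trans assoc (trans (⨾-congʳ α-iso₁) idʳ)) ⟩
    α⇐ ⨾ ((f ⊗₁ g) ⊗₁ h)                     ∎

  pentagon-α⇐ : ∀ {A B D E} →
    (α⇐ {A} {B} {D} ⊗₁ id {E}) ⨾ (α⇒ ⨾ α⇒) ≈ α⇒ ⨾ (id ⊗₁ α⇒)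
  pentagon-α⇐ = begin
    (α⇐ ⊗₁ id) ⨾ (α⇒ ⨾ α⇒)                             ≈⟨ ⨾-congʳ (sym pentagon) ⟩
    (α⇐ ⊗₁ id) ⨾ (((α⇒ ⊗₁ id) ⨾ α⇒) ⨾ (id ⊗₁ α⇒))     ≈⟨ trans assoc˘ (⨾-congˡ assoc˘) ⟩
    (((α⇐ ⊗₁ id) ⨾ (α⇒ ⊗₁ id)) ⨾ α⇒) ⨾ (id ⊗₁ α⇒)     ≈⟨ ⨾-congˡ (⨾-congˡ (⊗id-iso α-iso₂)) ⟩
    (id ⨾ α⇒) ⨾ (id ⊗₁ α⇒)                             ≈⟨ ⨾-congˡ idˡ ⟩
    α⇒ ⨾ (id ⊗₁ α⇒)                                    ∎

  pentagon⁻¹ : ∀ {A B D E} →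
    ((id {A} ⊗₁ α⇒ {B} {D} {E}) ⨾ α⇐) ⨾ α⇐ ≈ α⇐ ⨾ (α⇐ ⊗₁ id)
  pentagon⁻¹ {A} {B} {D} {E} = cancel-split-mono right-inverse (trans left-composite (sym right-composite))
    where
    -- both sides are inverse to the right-hand side of the pentagon
    right-inverse : ((α⇒ ⊗₁ id) ⨾ α⇒) ⨾ (α⇐ ⨾ (α⇐ ⊗₁ id {E})) ≈ id {((A ⊗₀ B) ⊗₀ D) ⊗₀ E}
    right-inverse = begin
      ((α⇒ ⊗₁ id) ⨾ α⇒) ⨾ (α⇐ ⨾ (α⇐ ⊗₁ id))  ≈⟨ trans assoc (⨾-congʳ assoc˘) ⟩
      (α⇒ ⊗₁ id) ⨾ ((α⇒ ⨾ α⇐) ⨾ (α⇐ ⊗₁ id))  ≈⟨ ⨾-congʳ (trans (⨾-congˡ α-iso₁) idˡ) ⟩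
      (α⇒ ⊗₁ id) ⨾ (α⇐ ⊗₁ id)                ≈⟨ ⊗id-iso α-iso₁ ⟩
      id                                     ∎

    right-composite : (α⇐ ⨾ (α⇐ ⊗₁ id)) ⨾ ((α⇒ ⊗₁ id) ⨾ α⇒) ≈ id {A ⊗₀ ((B ⊗₀ D) ⊗₀ E)}
    right-composite = begin
      (α⇐ ⨾ (α⇐ ⊗₁ id)) ⨾ ((α⇒ ⊗₁ id) ⨾ α⇒)  ≈⟨ trans assoc (⨾-congʳ assoc˘) ⟩
      α⇐ ⨾ (((α⇐ ⊗₁ id) ⨾ (α⇒ ⊗₁ id)) ⨾ α⇒)  ≈⟨ ⨾-congʳ (trans (⨾-congˡ (⊗id-iso α-iso₂)) idˡ) ⟩
      α⇐ ⨾ α⇒                                ≈⟨ α-iso₂ ⟩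
      id                                     ∎

    left-composite : (((id ⊗₁ α⇒) ⨾ α⇐) ⨾ α⇐) ⨾ ((α⇒ ⊗₁ id) ⨾ α⇒) ≈ id {A ⊗₀ ((B ⊗₀ D) ⊗₀ E)}
    left-composite = cancel-split-mono (id⊗-iso α-iso₁) (begin
      ((((id ⊗₁ α⇒) ⨾ α⇐) ⨾ α⇐) ⨾ ((α⇒ ⊗₁ id) ⨾ α⇒)) ⨾ (id ⊗₁ α⇒)
        ≈⟨ trans assoc (⨾-congʳ pentagon) ⟩
      (((id ⊗₁ α⇒) ⨾ α⇐) ⨾ α⇐) ⨾ (α⇒ ⨾ α⇒)
        ≈⟨ trans assoc (⨾-congʳ (trans assoc˘ (trans (⨾-congˡ α-iso₂) idˡ))) ⟩
      ((id ⊗₁ α⇒) ⨾ α⇐) ⨾ α⇒                 ≈⟨ trans assoc (trans (⨾-congʳ α-iso₂) idʳ) ⟩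
      id ⊗₁ α⇒                               ≈⟨ sym idˡ ⟩
      id ⨾ (id ⊗₁ α⇒)                        ∎)

module ClosedLemmas {o ℓ e} {I : Category o ℓ e} {M : Monoidal I} (Cl : Closed I M) where
  open Category I
  open Monoidal M
  open Closed Cl
  open HomReasoning I

  curryˡ-unique : ∀ {A X C} {g g' : Hom X (A ⧵ C)} →
                  (id ⊗₁ g) ⨾ evˡ ≈ (id ⊗₁ g') ⨾ evˡ → g ≈ g'
  curryˡ-unique eq = trans (sym curryˡ-η) (trans (curryˡ-resp eq) curryˡ-η)

  curryʳ-unique : ∀ {X B C} {g g' : Hom X (C / B)} →
                  (g ⊗₁ id) ⨾ evʳ ≈ (g' ⊗₁ id) ⨾ evʳ → g ≈ g'
  curryʳ-unique eq = trans (sym curryʳ-η) (trans (curryʳ-resp eq) curryʳ-η)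

module Continuation {o ℓ e} {I : Category o ℓ e} {M : Monoidal I} (Cl : Closed I M)
  (U : Category.Obj I) where
  open Category I
  open Monoidal M
  open Closed Cl
  open HomReasoning I
  open MonoidalLemmas M
  open ClosedLemmas Cl

  K : Obj → Obj
  K X = U / X

  R : Obj → Obj
  R X = X ⧵ U

  K₁ : ∀ {X Y} → Hom X Y → Hom (K Y) (K X)
  K₁ f = curryʳ ((id ⊗₁ f) ⨾ evʳ)

  R₁ : ∀ {X Y} → Hom Y X → Hom (R X) (R Y)
  R₁ f = curryˡ ((f ⊗₁ id) ⨾ evˡ)

  K₁-β : ∀ {X Y} {f : Hom X Y} → (K₁ f ⊗₁ id) ⨾ evʳ ≈ (id ⊗₁ f) ⨾ evʳ
  K₁-β = curryʳ-β

  R₁-β : ∀ {X Y} {f : Hom Y X} → (id ⊗₁ R₁ f) ⨾ evˡ ≈ (f ⊗₁ id) ⨾ evˡ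
  R₁-β = curryˡ-β

  K-id : ∀ {X} → K₁ (id {X}) ≈ id
  K-id = curryʳ-η

  R-id : ∀ {X} → R₁ (id {X}) ≈ id
  R-id = curryˡ-η

  K-resp : ∀ {X Y} {f g : Hom X Y} → f ≈ g → K₁ f ≈ K₁ g
  K-resp eq = curryʳ-resp (⨾-congˡ (id⊗-cong eq))

  R-resp : ∀ {X Y} {f g : Hom Y X} → f ≈ g → R₁ f ≈ R₁ g
  R-resp eq = curryˡ-resp (⨾-congˡ (⊗id-cong eq))

  K-⨾ : ∀ {X Y Z} {f : Hom X Y} {g : Hom Y Z} → K₁ (f ⨾ g) ≈ K₁ g ⨾ K₁ f
  K-⨾ {f = f} {g} = curryʳ-unique (sym (begin
    ((K₁ g ⨾ K₁ f) ⊗₁ id) ⨾ evʳ         ≈⟨ ⨾-⊗id-assoc ⟩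
    (K₁ g ⊗₁ id) ⨾ ((K₁ f ⊗₁ id) ⨾ evʳ) ≈⟨ ⨾-congʳ K₁-β ⟩
    (K₁ g ⊗₁ id) ⨾ ((id ⊗₁ f) ⨾ evʳ)    ≈⟨ ⊗-interchange-⨾ ⟩
    (id ⊗₁ f) ⨾ ((K₁ g ⊗₁ id) ⨾ evʳ)    ≈⟨ ⨾-congʳ K₁-β ⟩
    (id ⊗₁ f) ⨾ ((id ⊗₁ g) ⨾ evʳ)       ≈⟨ pullˡ (sym id⊗-⨾) ⟩
    (id ⊗₁ (f ⨾ g)) ⨾ evʳ               ≈⟨ sym K₁-β ⟩
    (K₁ (f ⨾ g) ⊗₁ id) ⨾ evʳ            ∎))

  R-⨾ : ∀ {X Y Z} {f : Hom X Y} {g : Hom Y Z} → R₁ (f ⨾ g) ≈ R₁ g ⨾ R₁ f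
  R-⨾ {f = f} {g} = curryˡ-unique (sym (begin
    (id ⊗₁ (R₁ g ⨾ R₁ f)) ⨾ evˡ          ≈⟨ id⊗-⨾-assoc ⟩
    (id ⊗₁ R₁ g) ⨾ ((id ⊗₁ R₁ f) ⨾ evˡ)  ≈⟨ ⨾-congʳ R₁-β ⟩
    (id ⊗₁ R₁ g) ⨾ ((f ⊗₁ id) ⨾ evˡ)     ≈⟨ sym ⊗-interchange-⨾ ⟩
    (f ⊗₁ id) ⨾ ((id ⊗₁ R₁ g) ⨾ evˡ)     ≈⟨ ⨾-congʳ R₁-β ⟩
    (f ⊗₁ id) ⨾ ((g ⊗₁ id) ⨾ evˡ)        ≈⟨ pullˡ (sym ⨾-⊗id) ⟩
    ((f ⨾ g) ⊗₁ id) ⨾ evˡ                ≈⟨ sym R₁-β ⟩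
    (id ⊗₁ R₁ (f ⨾ g)) ⨾ evˡ             ∎))

  unit : ∀ {X} → Hom X (R (K X))
  unit = curryˡ evʳ

  counit : ∀ {X} → Hom X (K (R X))
  counit = curryʳ evˡ

  unit-nat : ∀ {X Y} (f : Hom X Y) → f ⨾ unit ≈ unit ⨾ R₁ (K₁ f)
  unit-nat f = curryˡ-unique (begin
    (id ⊗₁ (f ⨾ unit)) ⨾ evˡ                 ≈⟨ id⊗-⨾-assoc ⟩
    (id ⊗₁ f) ⨾ ((id ⊗₁ unit) ⨾ evˡ)         ≈⟨ ⨾-congʳ curryˡ-β ⟩
    (id ⊗₁ f) ⨾ evʳ                          ≈⟨ sym K₁-β ⟩
    (K₁ f ⊗₁ id) ⨾ evʳ                       ≈⟨ ⨾-congʳ (sym curryˡ-β) ⟩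
    (K₁ f ⊗₁ id) ⨾ ((id ⊗₁ unit) ⨾ evˡ)      ≈⟨ ⊗-interchange-⨾ ⟩
    (id ⊗₁ unit) ⨾ ((K₁ f ⊗₁ id) ⨾ evˡ)      ≈⟨ ⨾-congʳ (sym R₁-β) ⟩
    (id ⊗₁ unit) ⨾ ((id ⊗₁ R₁ (K₁ f)) ⨾ evˡ) ≈⟨ sym id⊗-⨾-assoc ⟩
    (id ⊗₁ (unit ⨾ R₁ (K₁ f))) ⨾ evˡ         ∎)

  counit-nat : ∀ {X Y} (g : Hom Y X) → counit ⨾ K₁ (R₁ g) ≈ g ⨾ counit
  counit-nat g = curryʳ-unique (begin
    ((counit ⨾ K₁ (R₁ g)) ⊗₁ id) ⨾ evʳ         ≈⟨ ⨾-⊗id-assoc ⟩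
    (counit ⊗₁ id) ⨾ ((K₁ (R₁ g) ⊗₁ id) ⨾ evʳ) ≈⟨ ⨾-congʳ K₁-β ⟩
    (counit ⊗₁ id) ⨾ ((id ⊗₁ R₁ g) ⨾ evʳ)      ≈⟨ ⊗-interchange-⨾ ⟩
    (id ⊗₁ R₁ g) ⨾ ((counit ⊗₁ id) ⨾ evʳ)      ≈⟨ ⨾-congʳ curryʳ-β ⟩
    (id ⊗₁ R₁ g) ⨾ evˡ                         ≈⟨ R₁-β ⟩
    (g ⊗₁ id) ⨾ evˡ                            ≈⟨ ⨾-congʳ (sym curryʳ-β) ⟩
    (g ⊗₁ id) ⨾ ((counit ⊗₁ id) ⨾ evʳ)         ≈⟨ sym ⨾-⊗id-assoc ⟩
    ((g ⨾ counit) ⊗₁ id) ⨾ evʳ                 ∎)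

  zig : ∀ {X} → counit ⨾ K₁ (unit {X}) ≈ id
  zig = curryʳ-unique (begin
    ((counit ⨾ K₁ unit) ⊗₁ id) ⨾ evʳ         ≈⟨ ⨾-⊗id-assoc ⟩
    (counit ⊗₁ id) ⨾ ((K₁ unit ⊗₁ id) ⨾ evʳ) ≈⟨ ⨾-congʳ K₁-β ⟩
    (counit ⊗₁ id) ⨾ ((id ⊗₁ unit) ⨾ evʳ)    ≈⟨ ⊗-interchange-⨾ ⟩
    (id ⊗₁ unit) ⨾ ((counit ⊗₁ id) ⨾ evʳ)    ≈⟨ ⨾-congʳ curryʳ-β ⟩
    (id ⊗₁ unit) ⨾ evˡ                       ≈⟨ curryˡ-β ⟩
    evʳ                                      ≈⟨ id⊗id-intro ⟩
    (id ⊗₁ id) ⨾ evʳ                         ∎)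

  zag : ∀ {X} → unit ⨾ R₁ (counit {X}) ≈ id
  zag = curryˡ-unique (begin
    (id ⊗₁ (unit ⨾ R₁ counit)) ⨾ evˡ         ≈⟨ id⊗-⨾-assoc ⟩
    (id ⊗₁ unit) ⨾ ((id ⊗₁ R₁ counit) ⨾ evˡ) ≈⟨ ⨾-congʳ R₁-β ⟩
    (id ⊗₁ unit) ⨾ ((counit ⊗₁ id) ⨾ evˡ)    ≈⟨ sym ⊗-interchange-⨾ ⟩
    (counit ⊗₁ id) ⨾ ((id ⊗₁ unit) ⨾ evˡ)    ≈⟨ ⨾-congʳ curryˡ-β ⟩
    (counit ⊗₁ id) ⨾ evʳ                     ≈⟨ curryʳ-β ⟩
    evˡ                                      ≈⟨ id⊗id-intro ⟩
    (id ⊗₁ id) ⨾ evˡ                         ∎)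

  T₁ : ∀ {X Y} → Hom X Y → Hom (R (K X)) (R (K Y))
  T₁ f = R₁ (K₁ f)

  μ : ∀ {X} → Hom (R (K (R (K X)))) (R (K X))
  μ {X} = R₁ (counit {K X})

  -- a continuation of A ⊗ B, given an A, is a continuation of B
  κ : ∀ {X Y} → Hom (K (X ⊗₀ Y) ⊗₀ X) (K Y)
  κ = curryʳ (α⇒ ⨾ evʳ)

  κ-nat : ∀ {X X' Y Y'} (f : Hom X X') (g : Hom Y Y') →
          ((id ⊗₁ f) ⨾ κ) ⨾ K₁ g ≈ (K₁ (f ⊗₁ g) ⊗₁ id) ⨾ κ
  κ-nat f g = curryʳ-unique (begin
    ((((id ⊗₁ f) ⨾ κ) ⨾ K₁ g) ⊗₁ id) ⨾ evʳ              ≈⟨ ⨾-⊗id-assoc ⟩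
    (((id ⊗₁ f) ⨾ κ) ⊗₁ id) ⨾ ((K₁ g ⊗₁ id) ⨾ evʳ)      ≈⟨ ⨾-congʳ K₁-β ⟩
    (((id ⊗₁ f) ⨾ κ) ⊗₁ id) ⨾ ((id ⊗₁ g) ⨾ evʳ)         ≈⟨ ⨾-⊗id-assoc ⟩
    ((id ⊗₁ f) ⊗₁ id) ⨾ ((κ ⊗₁ id) ⨾ ((id ⊗₁ g) ⨾ evʳ)) ≈⟨ ⨾-congʳ ⊗-interchange-⨾ ⟩
    ((id ⊗₁ f) ⊗₁ id) ⨾ ((id ⊗₁ g) ⨾ ((κ ⊗₁ id) ⨾ evʳ)) ≈⟨ ⨾-congʳ (⨾-congʳ curryʳ-β) ⟩
    ((id ⊗₁ f) ⊗₁ id) ⨾ ((id ⊗₁ g) ⨾ (α⇒ ⨾ evʳ))        ≈⟨ assoc˘ ⟩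
    (((id ⊗₁ f) ⊗₁ id) ⨾ (id ⊗₁ g)) ⨾ (α⇒ ⨾ evʳ)        ≈⟨ ⨾-congˡ (sym ⊗-split₁) ⟩
    ((id ⊗₁ f) ⊗₁ g) ⨾ (α⇒ ⨾ evʳ)                       ≈⟨ pullˡ α-nat ⟩
    (α⇒ ⨾ (id ⊗₁ (f ⊗₁ g))) ⨾ evʳ                       ≈⟨ assoc ⟩
    α⇒ ⨾ ((id ⊗₁ (f ⊗₁ g)) ⨾ evʳ)                       ≈⟨ ⨾-congʳ (sym K₁-β) ⟩
    α⇒ ⨾ ((K₁ (f ⊗₁ g) ⊗₁ id) ⨾ evʳ)                    ≈⟨ ⨾-congʳ (⨾-congˡ (⊗-resp refl (sym ⊗-id))) ⟩
    α⇒ ⨾ ((K₁ (f ⊗₁ g) ⊗₁ (id ⊗₁ id)) ⨾ evʳ)            ≈⟨ pullˡ (sym α-nat) ⟩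
    (((K₁ (f ⊗₁ g) ⊗₁ id) ⊗₁ id) ⨾ α⇒) ⨾ evʳ            ≈⟨ trans assoc (⨾-congʳ (sym curryʳ-β)) ⟩
    ((K₁ (f ⊗₁ g) ⊗₁ id) ⊗₁ id) ⨾ ((κ ⊗₁ id) ⨾ evʳ)     ≈⟨ sym ⨾-⊗id-assoc ⟩
    (((K₁ (f ⊗₁ g) ⊗₁ id) ⨾ κ) ⊗₁ id) ⨾ evʳ             ∎)

  -- the strength A ⊗ T B → T (A ⊗ B): pass the A on to the continuation via κ
  σ : ∀ {X Y} → Hom (X ⊗₀ R (K Y)) (R (K (X ⊗₀ Y)))
  σ = curryˡ (α⇐ ⨾ (κ ⊗₁ id) ⨾ evˡ)

  σ-β : ∀ {X Y} → (id ⊗₁ σ {X} {Y}) ⨾ evˡ ≈ α⇐ ⨾ ((κ ⊗₁ id) ⨾ evˡ)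
  σ-β = trans curryˡ-β assoc

  σ-nat : ∀ {X X' Y Y'} (f : Hom X X') (g : Hom Y Y') →
           (f ⊗₁ T₁ g) ⨾ σ ≈ σ ⨾ T₁ (f ⊗₁ g)
  σ-nat f g = curryˡ-unique (begin
    (id ⊗₁ ((f ⊗₁ T₁ g) ⨾ σ)) ⨾ evˡ ≈⟨ id⊗-⨾-assoc ⟩
    (id ⊗₁ (f ⊗₁ T₁ g)) ⨾ ((id ⊗₁ σ) ⨾ evˡ) ≈⟨ ⨾-congʳ σ-β ⟩
    (id ⊗₁ (f ⊗₁ T₁ g)) ⨾ (α⇐ ⨾ ((κ ⊗₁ id) ⨾ evˡ)) ≈⟨ extend α⇐-nat ⟩
    α⇐ ⨾ (((id ⊗₁ f) ⊗₁ T₁ g) ⨾ ((κ ⊗₁ id) ⨾ evˡ)) ≈⟨ ⨾-congʳ (trans (⨾-congˡ ⊗-split₂) assoc) ⟩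
    α⇐ ⨾ ((id ⊗₁ T₁ g) ⨾ (((id ⊗₁ f) ⊗₁ id) ⨾ ((κ ⊗₁ id) ⨾ evˡ))) ≈⟨ ⨾-congʳ (⨾-congʳ (sym ⨾-⊗id-assoc)) ⟩
    α⇐ ⨾ ((id ⊗₁ T₁ g) ⨾ ((((id ⊗₁ f) ⨾ κ) ⊗₁ id) ⨾ evˡ)) ≈⟨ ⨾-congʳ (sym ⊗-interchange-⨾) ⟩
    α⇐ ⨾ ((((id ⊗₁ f) ⨾ κ) ⊗₁ id) ⨾ ((id ⊗₁ T₁ g) ⨾ evˡ)) ≈⟨ ⨾-congʳ (⨾-congʳ R₁-β) ⟩
    α⇐ ⨾ ((((id ⊗₁ f) ⨾ κ) ⊗₁ id) ⨾ ((K₁ g ⊗₁ id) ⨾ evˡ)) ≈⟨ ⨾-congʳ (sym ⨾-⊗id-assoc) ⟩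
    α⇐ ⨾ (((((id ⊗₁ f) ⨾ κ) ⨾ K₁ g) ⊗₁ id) ⨾ evˡ) ≈⟨ ⨾-congʳ (⨾-congˡ (⊗id-cong (κ-nat f g))) ⟩
    α⇐ ⨾ ((((K₁ (f ⊗₁ g) ⊗₁ id) ⨾ κ) ⊗₁ id) ⨾ evˡ) ≈⟨ ⨾-congʳ ⨾-⊗id-assoc ⟩
    α⇐ ⨾ (((K₁ (f ⊗₁ g) ⊗₁ id) ⊗₁ id) ⨾ ((κ ⊗₁ id) ⨾ evˡ)) ≈⟨ pullˡ (sym α⇐-nat) ⟩
    ((K₁ (f ⊗₁ g) ⊗₁ (id ⊗₁ id)) ⨾ α⇐) ⨾ ((κ ⊗₁ id) ⨾ evˡ) ≈⟨ ⨾-congˡ (⨾-congˡ (⊗-resp refl ⊗-id)) ⟩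
    ((K₁ (f ⊗₁ g) ⊗₁ id) ⨾ α⇐) ⨾ ((κ ⊗₁ id) ⨾ evˡ) ≈⟨ trans assoc (⨾-congʳ (sym σ-β)) ⟩
    (K₁ (f ⊗₁ g) ⊗₁ id) ⨾ ((id ⊗₁ σ) ⨾ evˡ) ≈⟨ ⊗-interchange-⨾ ⟩
    (id ⊗₁ σ) ⨾ ((K₁ (f ⊗₁ g) ⊗₁ id) ⨾ evˡ) ≈⟨ ⨾-congʳ (sym R₁-β) ⟩
    (id ⊗₁ σ) ⨾ ((id ⊗₁ T₁ (f ⊗₁ g)) ⨾ evˡ) ≈⟨ sym id⊗-⨾-assoc ⟩
    (id ⊗₁ (σ ⨾ T₁ (f ⊗₁ g))) ⨾ evˡ ∎)

  σ-η : ∀ {X Y} → (id {X} ⊗₁ unit {Y}) ⨾ σ ≈ unit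
  σ-η = curryˡ-unique (begin
    (id ⊗₁ ((id ⊗₁ unit) ⨾ σ)) ⨾ evˡ                ≈⟨ id⊗-⨾-assoc ⟩
    (id ⊗₁ (id ⊗₁ unit)) ⨾ ((id ⊗₁ σ) ⨾ evˡ)        ≈⟨ ⨾-congʳ σ-β ⟩
    (id ⊗₁ (id ⊗₁ unit)) ⨾ (α⇐ ⨾ ((κ ⊗₁ id) ⨾ evˡ)) ≈⟨ extend α⇐-nat ⟩
    α⇐ ⨾ (((id ⊗₁ id) ⊗₁ unit) ⨾ ((κ ⊗₁ id) ⨾ evˡ)) ≈⟨ ⨾-congʳ (⨾-congˡ (⊗-resp ⊗-id refl)) ⟩
    α⇐ ⨾ ((id ⊗₁ unit) ⨾ ((κ ⊗₁ id) ⨾ evˡ))         ≈⟨ ⨾-congʳ (sym ⊗-interchange-⨾) ⟩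
    α⇐ ⨾ ((κ ⊗₁ id) ⨾ ((id ⊗₁ unit) ⨾ evˡ))         ≈⟨ ⨾-congʳ (⨾-congʳ curryˡ-β) ⟩
    α⇐ ⨾ ((κ ⊗₁ id) ⨾ evʳ)                          ≈⟨ ⨾-congʳ curryʳ-β ⟩
    α⇐ ⨾ (α⇒ ⨾ evʳ)                                 ≈⟨ cancelˡ α-iso₂ ⟩
    evʳ                                             ≈⟨ sym curryˡ-β ⟩
    (id ⊗₁ unit) ⨾ evˡ                              ∎)

  κ-λ : ∀ {Y} → (K₁ (λ⇒ {Y}) ⊗₁ id) ⨾ κ ≈ ρ⇒ {K Y}
  κ-λ = curryʳ-unique (begin
    (((K₁ λ⇒ ⊗₁ id) ⨾ κ) ⊗₁ id) ⨾ evʳ         ≈⟨ ⨾-⊗id-assoc ⟩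
    ((K₁ λ⇒ ⊗₁ id) ⊗₁ id) ⨾ ((κ ⊗₁ id) ⨾ evʳ) ≈⟨ ⨾-congʳ curryʳ-β ⟩
    ((K₁ λ⇒ ⊗₁ id) ⊗₁ id) ⨾ (α⇒ ⨾ evʳ)        ≈⟨ extend α-nat ⟩
    α⇒ ⨾ ((K₁ λ⇒ ⊗₁ (id ⊗₁ id)) ⨾ evʳ)        ≈⟨ ⨾-congʳ (⨾-congˡ (⊗-resp refl ⊗-id)) ⟩
    α⇒ ⨾ ((K₁ λ⇒ ⊗₁ id) ⨾ evʳ)                ≈⟨ ⨾-congʳ K₁-β ⟩
    α⇒ ⨾ ((id ⊗₁ λ⇒) ⨾ evʳ)                   ≈⟨ pullˡ triangle ⟩
    (ρ⇒ ⊗₁ id) ⨾ evʳ                          ∎)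

  σ-λ : ∀ {Y} → σ {𝟙} {Y} ⨾ T₁ (λ⇒ {Y}) ≈ λ⇒
  σ-λ = curryˡ-unique (begin
    (id ⊗₁ (σ ⨾ T₁ λ⇒)) ⨾ evˡ                        ≈⟨ id⊗-⨾-assoc ⟩
    (id ⊗₁ σ) ⨾ ((id ⊗₁ T₁ λ⇒) ⨾ evˡ)                ≈⟨ ⨾-congʳ R₁-β ⟩
    (id ⊗₁ σ) ⨾ ((K₁ λ⇒ ⊗₁ id) ⨾ evˡ)                ≈⟨ sym ⊗-interchange-⨾ ⟩
    (K₁ λ⇒ ⊗₁ id) ⨾ ((id ⊗₁ σ) ⨾ evˡ)                ≈⟨ ⨾-congʳ σ-β ⟩
    (K₁ λ⇒ ⊗₁ id) ⨾ (α⇐ ⨾ ((κ ⊗₁ id) ⨾ evˡ))         ≈⟨ ⨾-congˡ (⊗-resp refl (sym ⊗-id)) ⟩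
    (K₁ λ⇒ ⊗₁ (id ⊗₁ id)) ⨾ (α⇐ ⨾ ((κ ⊗₁ id) ⨾ evˡ)) ≈⟨ extend α⇐-nat ⟩
    α⇐ ⨾ (((K₁ λ⇒ ⊗₁ id) ⊗₁ id) ⨾ ((κ ⊗₁ id) ⨾ evˡ)) ≈⟨ ⨾-congʳ (sym ⨾-⊗id-assoc) ⟩
    α⇐ ⨾ ((((K₁ λ⇒ ⊗₁ id) ⨾ κ) ⊗₁ id) ⨾ evˡ)         ≈⟨ ⨾-congʳ (⨾-congˡ (⊗id-cong κ-λ)) ⟩
    α⇐ ⨾ ((ρ⇒ ⊗₁ id) ⨾ evˡ)                          ≈⟨ ⨾-congʳ (⨾-congˡ (sym triangle)) ⟩
    α⇐ ⨾ ((α⇒ ⨾ (id ⊗₁ λ⇒)) ⨾ evˡ)                   ≈⟨ trans (⨾-congʳ assoc) (cancelˡ α-iso₂) ⟩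
    (id ⊗₁ λ⇒) ⨾ evˡ                                 ∎)

  κ-α : ∀ {X Y Z} →
       (K₁ (α⇒ {X} {Y} {Z}) ⊗₁ id) ⨾ κ ≈ (α⇐ ⨾ (κ ⊗₁ id)) ⨾ κ
  κ-α = curryʳ-unique (begin
    (((K₁ α⇒ ⊗₁ id) ⨾ κ) ⊗₁ id) ⨾ evʳ             ≈⟨ ⨾-⊗id-assoc ⟩
    ((K₁ α⇒ ⊗₁ id) ⊗₁ id) ⨾ ((κ ⊗₁ id) ⨾ evʳ)     ≈⟨ ⨾-congʳ curryʳ-β ⟩
    ((K₁ α⇒ ⊗₁ id) ⊗₁ id) ⨾ (α⇒ ⨾ evʳ)            ≈⟨ extend α-nat ⟩
    α⇒ ⨾ ((K₁ α⇒ ⊗₁ (id ⊗₁ id)) ⨾ evʳ)            ≈⟨ ⨾-congʳ (⨾-congˡ (⊗-resp refl ⊗-id)) ⟩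
    α⇒ ⨾ ((K₁ α⇒ ⊗₁ id) ⨾ evʳ)                    ≈⟨ ⨾-congʳ K₁-β ⟩
    α⇒ ⨾ ((id ⊗₁ α⇒) ⨾ evʳ)                       ≈⟨ extend (sym pentagon-α⇐) ⟩
    (α⇐ ⊗₁ id) ⨾ ((α⇒ ⨾ α⇒) ⨾ evʳ)                ≈⟨ ⨾-congʳ assoc ⟩
    (α⇐ ⊗₁ id) ⨾ (α⇒ ⨾ (α⇒ ⨾ evʳ))                ≈⟨ ⨾-congʳ (⨾-congʳ (sym curryʳ-β)) ⟩
    (α⇐ ⊗₁ id) ⨾ (α⇒ ⨾ ((κ ⊗₁ id) ⨾ evʳ))         ≈⟨ ⨾-congʳ (⨾-congʳ (⨾-congˡ (⊗-resp refl (sym ⊗-id)))) ⟩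
    (α⇐ ⊗₁ id) ⨾ (α⇒ ⨾ ((κ ⊗₁ (id ⊗₁ id)) ⨾ evʳ)) ≈⟨ ⨾-congʳ (extend (sym α-nat)) ⟩
    (α⇐ ⊗₁ id) ⨾ (((κ ⊗₁ id) ⊗₁ id) ⨾ (α⇒ ⨾ evʳ)) ≈⟨ sym ⨾-⊗id-assoc ⟩
    ((α⇐ ⨾ (κ ⊗₁ id)) ⊗₁ id) ⨾ (α⇒ ⨾ evʳ)         ≈⟨ ⨾-congʳ (sym curryʳ-β) ⟩
    ((α⇐ ⨾ (κ ⊗₁ id)) ⊗₁ id) ⨾ ((κ ⊗₁ id) ⨾ evʳ)  ≈⟨ sym ⨾-⊗id-assoc ⟩
    (((α⇐ ⨾ (κ ⊗₁ id)) ⨾ κ) ⊗₁ id) ⨾ evʳ          ∎)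

  κ-twice : ∀ {X Y Z} →
            (α⇐ ⨾ (α⇐ ⊗₁ id)) ⨾ ((((κ ⊗₁ id) ⨾ κ) ⊗₁ id) ⨾ evˡ)
              ≈ (id ⊗₁ (α⇒ {X} {Y} {R (K Z)} ⨾ (id ⊗₁ σ {Y} {Z}) ⨾ σ {X} {Y ⊗₀ Z})) ⨾ evˡ
  κ-twice = begin
    (α⇐ ⨾ (α⇐ ⊗₁ id)) ⨾ ((((κ ⊗₁ id) ⨾ κ) ⊗₁ id) ⨾ evˡ) ≈⟨ ⨾-congˡ (sym pentagon⁻¹) ⟩
    (((id ⊗₁ α⇒) ⨾ α⇐) ⨾ α⇐) ⨾ ((((κ ⊗₁ id) ⨾ κ) ⊗₁ id) ⨾ evˡ) ≈⟨ trans assoc assoc ⟩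
    (id ⊗₁ α⇒) ⨾ (α⇐ ⨾ (α⇐ ⨾ ((((κ ⊗₁ id) ⨾ κ) ⊗₁ id) ⨾ evˡ))) ≈⟨ ⨾-congʳ (⨾-congʳ (⨾-congʳ ⨾-⊗id-assoc)) ⟩
    (id ⊗₁ α⇒) ⨾ (α⇐ ⨾ (α⇐ ⨾ (((κ ⊗₁ id) ⊗₁ id) ⨾ ((κ ⊗₁ id) ⨾ evˡ)))) ≈⟨ ⨾-congʳ (⨾-congʳ (extend (sym α⇐-nat))) ⟩
    (id ⊗₁ α⇒) ⨾ (α⇐ ⨾ ((κ ⊗₁ (id ⊗₁ id)) ⨾ (α⇐ ⨾ ((κ ⊗₁ id) ⨾ evˡ)))) ≈⟨ ⨾-congʳ (⨾-congʳ (⨾-congˡ (⊗-resp refl ⊗-id))) ⟩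
    (id ⊗₁ α⇒) ⨾ (α⇐ ⨾ ((κ ⊗₁ id) ⨾ (α⇐ ⨾ ((κ ⊗₁ id) ⨾ evˡ)))) ≈⟨ ⨾-congʳ (⨾-congʳ (⨾-congʳ (sym σ-β))) ⟩
    (id ⊗₁ α⇒) ⨾ (α⇐ ⨾ ((κ ⊗₁ id) ⨾ ((id ⊗₁ σ) ⨾ evˡ))) ≈⟨ ⨾-congʳ (⨾-congʳ ⊗-interchange-⨾) ⟩
    (id ⊗₁ α⇒) ⨾ (α⇐ ⨾ ((id ⊗₁ σ) ⨾ ((κ ⊗₁ id) ⨾ evˡ))) ≈⟨ ⨾-congʳ (⨾-congʳ (⨾-congˡ (⊗-resp (sym ⊗-id) refl))) ⟩
    (id ⊗₁ α⇒) ⨾ (α⇐ ⨾ (((id ⊗₁ id) ⊗₁ σ) ⨾ ((κ ⊗₁ id) ⨾ evˡ))) ≈⟨ ⨾-congʳ (extend (sym α⇐-nat)) ⟩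
    (id ⊗₁ α⇒) ⨾ ((id ⊗₁ (id ⊗₁ σ)) ⨾ (α⇐ ⨾ ((κ ⊗₁ id) ⨾ evˡ))) ≈⟨ ⨾-congʳ (⨾-congʳ (sym σ-β)) ⟩
    (id ⊗₁ α⇒) ⨾ ((id ⊗₁ (id ⊗₁ σ)) ⨾ ((id ⊗₁ σ) ⨾ evˡ)) ≈⟨ pullˡ (sym id⊗-⨾) ⟩
    (id ⊗₁ (α⇒ ⨾ (id ⊗₁ σ))) ⨾ ((id ⊗₁ σ) ⨾ evˡ) ≈⟨ sym id⊗-⨾-assoc ⟩
    (id ⊗₁ (α⇒ ⨾ (id ⊗₁ σ) ⨾ σ)) ⨾ evˡ ∎


  σ-α : ∀ {X Y Z} →
         σ {X ⊗₀ Y} {Z} ⨾ T₁ (α⇒ {X} {Y} {Z})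
           ≈ α⇒ {X} {Y} {R (K Z)} ⨾ (id {X} ⊗₁ σ {Y} {Z}) ⨾ σ {X} {Y ⊗₀ Z}
  σ-α = curryˡ-unique (trans (begin
    (id ⊗₁ (σ ⨾ T₁ α⇒)) ⨾ evˡ ≈⟨ id⊗-⨾-assoc ⟩
    (id ⊗₁ σ) ⨾ ((id ⊗₁ T₁ α⇒) ⨾ evˡ) ≈⟨ ⨾-congʳ R₁-β ⟩
    (id ⊗₁ σ) ⨾ ((K₁ α⇒ ⊗₁ id) ⨾ evˡ) ≈⟨ sym ⊗-interchange-⨾ ⟩
    (K₁ α⇒ ⊗₁ id) ⨾ ((id ⊗₁ σ) ⨾ evˡ) ≈⟨ ⨾-congʳ σ-β ⟩
    (K₁ α⇒ ⊗₁ id) ⨾ (α⇐ ⨾ ((κ ⊗₁ id) ⨾ evˡ)) ≈⟨ ⨾-congˡ (⊗-resp refl (sym ⊗-id)) ⟩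
    (K₁ α⇒ ⊗₁ (id ⊗₁ id)) ⨾ (α⇐ ⨾ ((κ ⊗₁ id) ⨾ evˡ)) ≈⟨ extend α⇐-nat ⟩
    α⇐ ⨾ (((K₁ α⇒ ⊗₁ id) ⊗₁ id) ⨾ ((κ ⊗₁ id) ⨾ evˡ)) ≈⟨ ⨾-congʳ (sym ⨾-⊗id-assoc) ⟩
    α⇐ ⨾ ((((K₁ α⇒ ⊗₁ id) ⨾ κ) ⊗₁ id) ⨾ evˡ) ≈⟨ ⨾-congʳ (⨾-congˡ (⊗id-cong κ-α)) ⟩
    α⇐ ⨾ ((((α⇐ ⨾ (κ ⊗₁ id)) ⨾ κ) ⊗₁ id) ⨾ evˡ) ≈⟨ ⨾-congʳ (⨾-congˡ (⊗id-cong assoc)) ⟩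
    α⇐ ⨾ (((α⇐ ⨾ ((κ ⊗₁ id) ⨾ κ)) ⊗₁ id) ⨾ evˡ) ≈⟨ ⨾-congʳ ⨾-⊗id-assoc ⟩
    α⇐ ⨾ ((α⇐ ⊗₁ id) ⨾ ((((κ ⊗₁ id) ⨾ κ) ⊗₁ id) ⨾ evˡ)) ≈⟨ assoc˘ ⟩
    (α⇐ ⨾ (α⇐ ⊗₁ id)) ⨾ ((((κ ⊗₁ id) ⨾ κ) ⊗₁ id) ⨾ evˡ) ∎) κ-twice)

  κ-μ : ∀ {X Y} →
       κ {X} {Y} ⨾ counit ≈ ((counit ⨾ K₁ (σ {X} {Y})) ⊗₁ id) ⨾ κ
  κ-μ = curryʳ-unique (begin
    ((κ ⨾ counit) ⊗₁ id) ⨾ evʳ                          ≈⟨ ⨾-⊗id-assoc ⟩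
    (κ ⊗₁ id) ⨾ ((counit ⊗₁ id) ⨾ evʳ)                  ≈⟨ ⨾-congʳ curryʳ-β ⟩
    (κ ⊗₁ id) ⨾ evˡ                                     ≈⟨ sym (cancelˡ α-iso₁) ⟩
    α⇒ ⨾ (α⇐ ⨾ ((κ ⊗₁ id) ⨾ evˡ))                       ≈⟨ ⨾-congʳ (sym σ-β) ⟩
    α⇒ ⨾ ((id ⊗₁ σ) ⨾ evˡ)                              ≈⟨ ⨾-congʳ (⨾-congʳ (sym curryʳ-β)) ⟩
    α⇒ ⨾ ((id ⊗₁ σ) ⨾ ((counit ⊗₁ id) ⨾ evʳ))           ≈⟨ ⨾-congʳ (sym ⊗-interchange-⨾) ⟩
    α⇒ ⨾ ((counit ⊗₁ id) ⨾ ((id ⊗₁ σ) ⨾ evʳ))           ≈⟨ ⨾-congʳ (⨾-congʳ (sym K₁-β)) ⟩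
    α⇒ ⨾ ((counit ⊗₁ id) ⨾ ((K₁ σ ⊗₁ id) ⨾ evʳ))        ≈⟨ ⨾-congʳ (sym ⨾-⊗id-assoc) ⟩
    α⇒ ⨾ (((counit ⨾ K₁ σ) ⊗₁ id) ⨾ evʳ)                ≈⟨ ⨾-congʳ (⨾-congˡ (⊗-resp refl (sym ⊗-id))) ⟩
    α⇒ ⨾ (((counit ⨾ K₁ σ) ⊗₁ (id ⊗₁ id)) ⨾ evʳ)        ≈⟨ extend (sym α-nat) ⟩
    (((counit ⨾ K₁ σ) ⊗₁ id) ⊗₁ id) ⨾ (α⇒ ⨾ evʳ)        ≈⟨ ⨾-congʳ (sym curryʳ-β) ⟩
    (((counit ⨾ K₁ σ) ⊗₁ id) ⊗₁ id) ⨾ ((κ ⊗₁ id) ⨾ evʳ) ≈⟨ sym ⨾-⊗id-assoc ⟩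
    ((((counit ⨾ K₁ σ) ⊗₁ id) ⨾ κ) ⊗₁ id) ⨾ evʳ         ∎)

  σ-μ : ∀ {X Y} →
         (id {X} ⊗₁ μ {Y}) ⨾ σ
           ≈ σ {X} {R (K Y)} ⨾ T₁ (σ {X} {Y}) ⨾ μ {X ⊗₀ Y}
  σ-μ = curryˡ-unique (begin
    (id ⊗₁ ((id ⊗₁ μ) ⨾ σ)) ⨾ evˡ                              ≈⟨ id⊗-⨾-assoc ⟩
    (id ⊗₁ (id ⊗₁ μ)) ⨾ ((id ⊗₁ σ) ⨾ evˡ)                      ≈⟨ ⨾-congʳ σ-β ⟩
    (id ⊗₁ (id ⊗₁ μ)) ⨾ (α⇐ ⨾ ((κ ⊗₁ id) ⨾ evˡ))               ≈⟨ extend α⇐-nat ⟩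
    α⇐ ⨾ (((id ⊗₁ id) ⊗₁ μ) ⨾ ((κ ⊗₁ id) ⨾ evˡ))               ≈⟨ ⨾-congʳ (⨾-congˡ (⊗-resp ⊗-id refl)) ⟩
    α⇐ ⨾ ((id ⊗₁ μ) ⨾ ((κ ⊗₁ id) ⨾ evˡ))                       ≈⟨ ⨾-congʳ (sym ⊗-interchange-⨾) ⟩
    α⇐ ⨾ ((κ ⊗₁ id) ⨾ ((id ⊗₁ μ) ⨾ evˡ))                       ≈⟨ ⨾-congʳ (⨾-congʳ R₁-β) ⟩
    α⇐ ⨾ ((κ ⊗₁ id) ⨾ ((counit ⊗₁ id) ⨾ evˡ))                  ≈⟨ ⨾-congʳ (sym ⨾-⊗id-assoc) ⟩
    α⇐ ⨾ (((κ ⨾ counit) ⊗₁ id) ⨾ evˡ)                          ≈⟨ ⨾-congʳ (⨾-congˡ (⊗id-cong κ-μ)) ⟩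
    α⇐ ⨾ (((((counit ⨾ K₁ σ) ⊗₁ id) ⨾ κ) ⊗₁ id) ⨾ evˡ)         ≈⟨ ⨾-congʳ ⨾-⊗id-assoc ⟩
    α⇐ ⨾ ((((counit ⨾ K₁ σ) ⊗₁ id) ⊗₁ id) ⨾ ((κ ⊗₁ id) ⨾ evˡ)) ≈⟨ extend (sym α⇐-nat) ⟩
    ((counit ⨾ K₁ σ) ⊗₁ (id ⊗₁ id)) ⨾ (α⇐ ⨾ ((κ ⊗₁ id) ⨾ evˡ)) ≈⟨ ⨾-congˡ (⊗-resp refl ⊗-id) ⟩
    ((counit ⨾ K₁ σ) ⊗₁ id) ⨾ (α⇐ ⨾ ((κ ⊗₁ id) ⨾ evˡ))         ≈⟨ ⨾-congʳ (sym σ-β) ⟩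
    ((counit ⨾ K₁ σ) ⊗₁ id) ⨾ ((id ⊗₁ σ) ⨾ evˡ)                ≈⟨ ⨾-⊗id-assoc ⟩
    (counit ⊗₁ id) ⨾ ((K₁ σ ⊗₁ id) ⨾ ((id ⊗₁ σ) ⨾ evˡ))        ≈⟨ ⨾-congʳ ⊗-interchange-⨾ ⟩
    (counit ⊗₁ id) ⨾ ((id ⊗₁ σ) ⨾ ((K₁ σ ⊗₁ id) ⨾ evˡ))        ≈⟨ ⨾-congʳ (⨾-congʳ (sym R₁-β)) ⟩
    (counit ⊗₁ id) ⨾ ((id ⊗₁ σ) ⨾ ((id ⊗₁ T₁ σ) ⨾ evˡ))        ≈⟨ ⨾-congʳ (sym id⊗-⨾-assoc) ⟩
    (counit ⊗₁ id) ⨾ ((id ⊗₁ (σ ⨾ T₁ σ)) ⨾ evˡ)                ≈⟨ ⊗-interchange-⨾ ⟩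
    (id ⊗₁ (σ ⨾ T₁ σ)) ⨾ ((counit ⊗₁ id) ⨾ evˡ)                ≈⟨ ⨾-congʳ (sym R₁-β) ⟩
    (id ⊗₁ (σ ⨾ T₁ σ)) ⨾ ((id ⊗₁ μ) ⨾ evˡ)                     ≈⟨ sym id⊗-⨾-assoc ⟩
    (id ⊗₁ (σ ⨾ T₁ σ ⨾ μ)) ⨾ evˡ                               ∎)


module Total {o ℓ e o' ℓ' e'} {I : Category o ℓ e} {M : Monoidal I} {Cl : Closed I M}
  {p : RefSys I o' ℓ' e'} {Mp : MonoidalRS I M p} (Clp : ClosedRS I M Cl p Mp) where
  open Category I
  open Monoidal M
  open Closed Cl
  open RefSys p
  open MonoidalRS Mp
  open ClosedRS Clp

  category : Category (o ⊔ o') (ℓ ⊔ ℓ') e'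
  category = record
    { Obj     = Σ Obj Ref
    ; Hom     = λ X Y → Σ (Hom (proj₁ X) (proj₁ Y)) (λ f → Der f (proj₂ X) (proj₂ Y))
    ; _≈_     = λ x y → proj₂ x ≋ proj₂ y
    ; ≈-equiv = record { refl = ≋-refl ; sym = ≋-sym ; trans = ≋-trans }
    ; id      = id , idᵉ
    ; _⨾_     = λ x y → (proj₁ x ⨾ proj₁ y) , (proj₂ x ⨾ᵉ proj₂ y)
    ; assoc   = assocᵉ
    ; idˡ     = idˡᵉ
    ; idʳ     = idʳᵉ
    ; ⨾-resp  = ⨾ᵉ-resp
    }

  monoidal : Monoidal category
  monoidal = record
    { _⊗₀_ = λ X Y → (proj₁ X ⊗₀ proj₁ Y) , (proj₂ X ⊗ᵉ proj₂ Y)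
    ; _⊗₁_ = λ x y → (proj₁ x ⊗₁ proj₁ y) , (proj₂ x ⊗ᵉ₁ proj₂ y)
    ; ⊗-id = ⊗ᵉ-id ; ⊗-⨾ = ⊗ᵉ-⨾ ; ⊗-resp = ⊗ᵉ-resp
    ; 𝟙 = 𝟙 , 𝟙ᵉ
    ; α⇒ = α⇒ , αᵉ⇒ ; α⇐ = α⇐ , αᵉ⇐
    ; λ⇒ = λ⇒ , λᵉ⇒ ; λ⇐ = λ⇐ , λᵉ⇐
    ; ρ⇒ = ρ⇒ , ρᵉ⇒ ; ρ⇐ = ρ⇐ , ρᵉ⇐
    ; α-iso₁ = αᵉ-iso₁ ; α-iso₂ = αᵉ-iso₂
    ; λ-iso₁ = λᵉ-iso₁ ; λ-iso₂ = λᵉ-iso₂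
    ; ρ-iso₁ = ρᵉ-iso₁ ; ρ-iso₂ = ρᵉ-iso₂
    ; α-nat = αᵉ-nat ; λ-nat = λᵉ-nat ; ρ-nat = ρᵉ-nat
    ; pentagon = pentagonᵉ ; triangle = triangleᵉ
    }

  closed : Closed category monoidal
  closed = record
    { _⧵_ = λ X Y → (proj₁ X ⧵ proj₁ Y) , (proj₂ X ⧵ᵉ proj₂ Y)
    ; evˡ = evˡ , evˡᵉ
    ; curryˡ = λ x → curryˡ (proj₁ x) , Λˡ (proj₂ x)
    ; curryˡ-resp = Λˡ-resp ; curryˡ-β = Λˡ-β ; curryˡ-η = Λˡ-η
    ; _/_ = λ X Y → (proj₁ X / proj₁ Y) , (proj₂ X /ᵉ proj₂ Y)
    ; evʳ = evʳ , evʳᵉ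
    ; curryʳ = λ x → curryʳ (proj₁ x) , Λʳ (proj₂ x)
    ; curryʳ-resp = Λʳ-resp ; curryʳ-β = Λʳ-β ; curryʳ-η = Λʳ-η
    }

module ContinuationTRS {o ℓ e o' ℓ' e'} {I : Category o ℓ e} {M : Monoidal I}
  (Cl : Closed I M) {p : RefSys I o' ℓ' e'} (Mp : MonoidalRS I M p)
  (Clp : ClosedRS I M Cl p Mp) {C : Category.Obj I} (U : RefSys.Ref p C) where
  private
    module Base = Continuation Cl C
    module Ref  = Continuation (Total.closed Clp) (C , U)

  -- L₀ ⊣ R₀ is the continuation adjunction of I at C, and L₁ ⊣ R₁ that
  -- of ∫p at (C , U); the latter lies over the former because the
  -- first components of its unit and counit are those of the former.
  adjunction : ContinuationFunctors.ContinuationAdjunction I M Cl p Mp Clp U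
  adjunction = record
    { L0-functor = record { F-id = Base.K-id ; F-⨾ = Base.K-⨾ ; F-resp = Base.K-resp }
    ; R0-functor = record { F-id = Base.R-id ; F-⨾ = Base.R-⨾ ; F-resp = Base.R-resp }
    ; L1-functor = record
      { G-id   = λ {A} {S} → Ref.K-id {A , S}
      ; G-⨾    = λ {α = α} {β} → Ref.K-⨾ {f = _ , α} {g = _ , β}
      ; G-resp = λ {α = α} {β} → Ref.K-resp {f = _ , α} {g = _ , β} }
    ; R1-functor = record
      { G-id   = λ {A} {S} → Ref.R-id {A , S}
      ; G-⨾    = λ {α = α} {β} → Ref.R-⨾ {f = _ , β} {g = _ , α}
      ; G-resp = λ {α = α} {β} → Ref.R-resp {f = _ , α} {g = _ , β} }
    ; η      = Base.unit
    ; η-nat  = Base.unit-nat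
    ; ε      = Base.counit
    ; ε-nat  = Base.counit-nat
    ; tri₁   = Base.zig
    ; tri₂   = Base.zag
    ; ηᵉ     = λ {A} {S} → proj₂ (Ref.unit {A , S})
    ; ηᵉ-nat = λ α → Ref.unit-nat (_ , α)
    ; εᵉ     = λ {A} {S} → proj₂ (Ref.counit {A , S})
    ; εᵉ-nat = λ β → Ref.counit-nat (_ , β)
    ; triᵉ₁  = λ {A} {S} → Ref.zig {A , S}
    ; triᵉ₂  = λ {A} {S} → Ref.zag {A , S}
    }

  strength : InducedMonadIsStrong M Mp adjunction
  strength = record
    { σ      = Base.σ
    ; σ-nat  = Base.σ-nat
    ; σ-λ    = Base.σ-λ
    ; σ-α    = Base.σ-α
    ; σ-η    = Base.σ-η
    ; σ-μ    = Base.σ-μ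
    ; σᵉ     = λ {A} {B} {S} {T} → proj₂ (Ref.σ {A , S} {B , T})
    ; σᵉ-nat = λ α β → Ref.σ-nat (_ , α) (_ , β)
    ; σᵉ-λ   = λ {B} {T} → Ref.σ-λ {B , T}
    ; σᵉ-α   = λ {A} {B} {D} {S} {T} {V} → Ref.σ-α {A , S} {B , T} {D , V}
    ; σᵉ-η   = λ {A} {B} {S} {T} → Ref.σ-η {A , S} {B , T}
    ; σᵉ-μ   = λ {A} {B} {S} {T} → Ref.σ-μ {A , S} {B , T}
    }

mainTheorem5 : ∀ {o ℓ e o' ℓ' e'} (I : Category o ℓ e) (M : Monoidal I) (Cl : Closed I M)
    (p : RefSys I o' ℓ' e') (Mp : MonoidalRS I M p) (Clp : ClosedRS I M Cl p Mp)
    {C : Category.Obj I} (U : RefSys.Ref p C) →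
    Σ (ContinuationFunctors.ContinuationAdjunction I M Cl p Mp Clp U)
    (λ adj → InducedMonadIsStrong M Mp adj)
mainTheorem5 I M Cl p Mp Clp U = adjunction , strength
  where open ContinuationTRS Cl Mp Clp U
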